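{- Let $q$ be a prime power, $n\ge 2$, $a\in\mathrm{GF}(q^2)^*$ and $b\in\mathrm{GF}(q^2)\setminus\mathrm{GF}(q)$, and assume one of the following holds: (i) $n$ and $q$ are odd and $4a^{q+1}+(b^q-b)^2\neq 0$; (ii) $n$ is even, $q$ is odd and $4a^{q+1}+(b^q-b)^2$ is a non-square in $\mathrm{GF}(q)$; (iii) $n$ and $q$ are even and $\mathrm{Tr}\big(a^{q+1}/(b^q+b)^2\big)=0$; (iv) $n$ is odd and $q$ is even. Let $F$, $\mathcal{C}$, $\mathcal{R}$ and $F^g$ ($g\in\mathcal{R}$) be as in the context. Then $\{\mathcal{V}(F^g): g\in\mathcal{R}\}$ is a set of $q^{2n-2}$ pairwise distinct varieties of $\mathrm{PG}(n,q^2)$, and for any $g\neq g'$ in $\mathcal{R}$ the varieties $\mathcal{V}(F^g)$ and $\mathcal{V}(F^{g'})$ have exactly $q^{2n-2}$ common affine points, i.e. common points $[(x_0,\dots,x_n)]$ with $x_0\neq 0$.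
   Context: Points of $\mathrm{PG}(n,q^2)$ are written in homogeneous coordinates $[(x_0,\dots,x_n)]$; the affine points are those with $x_0\neq0$, identified with $(1,x_1,\dots,x_n)$. $\mathrm{Tr}(x)=x+x^q$ for $x\in\mathrm{GF}(q^2)$. Let $F(X_0,\dots,X_n)=X_0^qX_n^q-X_nX_0^{2q-1}+a^q(X_1^{2q}+\dots+X_{n-1}^{2q})-a(X_1^2+\dots+X_{n-1}^2)X_0^{2q-2}-(b^q-b)(X_1^{q+1}+\dots+X_{n-1}^{q+1})X_0^{q-1}$. Let $\mathcal{C}$ be a transversal of $\mathrm{GF}(q)$ in the additive group of $\mathrm{GF}(q^2)$ (a set of representatives of the cosets of $\mathrm{GF}(q)$) containing $0$. Let $\mathcal{R}$ be the set of $(n+1)\times(n+1)$ matrices $M'$ whose first row is $(1,\alpha_1,\dots,\alpha_n)$ and whose remaining rows are those of the identity matrix (i.e. row $i$ is $e_i$ for $i=1,\dots,n$), where $\alpha_1,\dots,\alpha_{n-1}\in\mathrm{GF}(q^2)$ are arbitrary and $\alpha_n$ is the unique element of $\mathcal{C}$ satisfying $\alpha_n^q-\alpha_n+a^q(\alpha_1^{2q}+\dots+\alpha_{n-1}^{2q})-a(\alpha_1^2+\dots+\alpha_{n-1}^2)=(b^q-b)(\alpha_1^{q+1}+\dots+\alpha_{n-1}^{q+1})$; thus $|\mathcal{R}|=q^{2n-2}$. For $g\in\mathcal{R}$ with matrix $M'$, $F^g$ denotes the form $F^g(X)=F(XM')$, where $X=(X_0,\dots,X_n)$ is a row vector, and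 $\mathcal{V}(H)$ denotes the set of points of $\mathrm{PG}(n,q^2)$ where the form $H$ vanishes. -}

module Defs where

open import Data.Nat as ℕ using (ℕ; zero; suc; _≤_; _<_; _∸_; _%_)
open import Data.Nat.Primality using (Prime)
open import Data.Fin using (Fin; zero; suc; toℕ; fromℕ)
open import Data.Bool using (Bool; true; false; if_then_else_; _∧_)
open import Data.List using (List; []; _∷_; length; filter; map; concatMap; foldr)
open import Data.List.Membership.Propositional using (_∈_)
open import Data.List.Relation.Unary.Unique.Propositional using (Unique)
open import Data.Product using (Σ; _×_; _,_)
open import Data.Vec.Functional as VF using (Vector)
open import Relation.Binary.PropositionalEquality using (_≡_)
open import Relation.Binary.Definitions using (DecidableEquality)
open import Relation.Nullary using (¬_; Dec; yes; no)
open import Relation.Nullary.Decidable using (_×-dec_; ⌊_⌋)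
open import Algebra.Structures using (IsCommutativeRing)
open import Function using (_⇔_)

IsPrimePower : ℕ → Set
IsPrimePower q = Σ ℕ λ p → Σ ℕ λ k → Prime p × (1 ≤ k) × (q ≡ p ℕ.^ k)

IsOdd : ℕ → Set
IsOdd m = m % 2 ≡ 1

IsEven : ℕ → Set
IsEven m = m % 2 ≡ 0

record FiniteField : Set₁ where
  infixl 6 _+_
  infixl 7 _*_
  field
    K : Set
    _+_ _*_ : K → K → K
    -_ : K → K
    0# 1# : K
    _⁻¹ : K → K
    isCommutativeRing : IsCommutativeRing _≡_ _+_ _*_ -_ 0# 1#
    0≢1 : ¬ (0# ≡ 1#)
    inverse : ∀ x → ¬ (x ≡ 0#) → x * (x ⁻¹) ≡ 1#
    _≟_ : DecidableEquality K
    elements : List K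
    complete : ∀ x → x ∈ elements
    unique : Unique elements

  size : ℕ
  size = length elements

module FieldDefs (𝔽 : FiniteField) where
  open FiniteField 𝔽 public

  infixl 6 _-_
  _-_ : K → K → K
  x - y = x + (- y)

  infixr 8 _^ᴷ_
  _^ᴷ_ : K → ℕ → K
  x ^ᴷ zero = 1#
  x ^ᴷ suc k = x * (x ^ᴷ k)

  infixl 7 _/_
  _/_ : K → K → K
  x / y = x * (y ⁻¹)

  4# : K
  4# = 1# + 1# + 1# + 1#

  -- the subfield GF(q) of GF(q^2): fixed points of x ↦ x^q
  InSub : ℕ → K → Set
  InSub q x = x ^ᴷ q ≡ x

  Tr : ℕ → K → K
  Tr q x = x + x ^ᴷ q

  NonSquareInSub : ℕ → K → Set
  NonSquareInSub q d = ¬ (Σ K λ y → InSub q y × (y * y ≡ d))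

  IsTransversal : ℕ → (K → Set) → Set
  IsTransversal q C =
    C 0#
    × (∀ x → Σ K λ c → C c × InSub q (c - x))
    × (∀ c c' → C c → C c' → InSub q (c - c') → c ≡ c')

  ΣF : ∀ {m} → (Fin m → K) → K
  ΣF {zero} f = 0#
  ΣF {suc m} f = f zero + ΣF (λ i → f (suc i))

  isMid : (n : ℕ) → Fin (suc n) → Bool
  isMid n j = ⌊ 1 ℕ.≤? toℕ j ⌋ ∧ ⌊ suc (toℕ j) ℕ.≤? n ⌋

  ΣMid : (n : ℕ) → (Fin (suc n) → K) → K
  ΣMid n f = ΣF (λ j → if isMid n j then f j else 0#)

  Point : ℕ → Set
  Point n = Fin (suc n) → K

  Form : ℕ → Set
  Form n = Point n → K

  Fform : (n q : ℕ) (a b : K) → Form n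
  Fform n q a b X =
        (X₀ ^ᴷ q) * (Xₙ ^ᴷ q)
      - Xₙ * (X₀ ^ᴷ (2 ℕ.* q ∸ 1))
      + (a ^ᴷ q) * ΣMid n (λ j → X j ^ᴷ (2 ℕ.* q))
      - a * ΣMid n (λ j → X j ^ᴷ 2) * (X₀ ^ᴷ (2 ℕ.* q ∸ 2))
      - (b ^ᴷ q - b) * ΣMid n (λ j → X j ^ᴷ (q ℕ.+ 1)) * (X₀ ^ᴷ (q ∸ 1))
    where
      X₀ = X zero
      Xₙ = X (fromℕ n)

  Matrix : ℕ → Set
  Matrix n = Fin (suc n) → Fin (suc n) → K

  δ : ∀ {m} → Fin m → Fin m → K
  δ i j with Data.Fin._≟_ i j
  ... | yes _ = 1#
  ... | no _ = 0#

  InR : (n q : ℕ) (a b : K) (C : K → Set) → Matrix n → Set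
  InR n q a b C M =
      (M zero zero ≡ 1#)
    × (∀ i j → M (suc i) j ≡ δ (suc i) j)
    × C αₙ
    × (αₙ ^ᴷ q - αₙ + (a ^ᴷ q) * ΣMid n (λ j → α j ^ᴷ (2 ℕ.* q))
                    - a * ΣMid n (λ j → α j ^ᴷ 2)
        ≡ (b ^ᴷ q - b) * ΣMid n (λ j → α j ^ᴷ (q ℕ.+ 1)))
    where
      α : Fin (suc n) → K
      α j = M zero j
      αₙ = α (fromℕ n)

  _·ᴹ_ : ∀ {n} → Point n → Matrix n → Point n
  (X ·ᴹ M) j = ΣF (λ i → X i * M i j)

  _^[_] : ∀ {n} → Form n → Matrix n → Form n
  (H ^[ M ]) X = H (X ·ᴹ M)

  NonZeroVec : ∀ {n} → Point n → Set
  NonZeroVec X = ¬ (∀ i → X i ≡ 0#)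

  -- 𝓥(H) = 𝓥(H') as sets of points of PG(n,q²) (for homogeneous forms,
  -- vanishing at a point = vanishing at any/every representative vector)
  SameVariety : ∀ {n} → Form n → Form n → Set
  SameVariety H H' = ∀ X → NonZeroVec X → (H X ≡ 0# ⇔ H' X ≡ 0#)

  allVecs : (m : ℕ) → List (Fin m → K)
  allVecs zero = (λ ()) ∷ []
  allVecs (suc m) = concatMap (λ c → map (λ v → c VF.∷ v) (allVecs m)) elements

  commonAffine : (n : ℕ) → Form n → Form n → ℕ
  commonAffine n H H' =
    length (filter (λ x → (H (1# VF.∷ x) ≟ 0#) ×-dec (H' (1# VF.∷ x) ≟ 0#)) (allVecs n))

module Submission where

-- Write φ x = x ^ q, T x = x ^ q − x and L w x = w x ^ q − w ^ q x on K = GF(q²). At an affine point,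
-- F^g (1, x) = T (α_n + x_n) + Σ_j Q (α_j + x_j) with Q y = a^q y^(2q) − a y² − (b^q − b) y^(q+1), and
-- Q (α + y) = Q α + Q y + L (u α) y where u α = 2 a^q α^q − (b^q − b) α. The defining equation of 𝓡 kills the
-- constant part, so F^g (1, x) = T x_n + Σ_j (Q x_j + L (u α_j) x_j), and two such forms differ by
-- Σ_j L (w_j) x_j with w_j = u α_j − u α′_j. Every value of Q and L has trace zero, and above a trace-zero value
-- both T and L w (w ≠ 0) have fibres of exactly q points. Counting coordinate by coordinate gives q · q^(2n−2)
-- affine zeros of F^g and q^(2n−2) common ones once some w_j ≠ 0: u is injective when
-- D = 4 a^(q+1) + (b^q − b)² ≠ 0, which is what the four conditions guarantee, and the transversal 𝒞 makes
-- distinct g differ in some α_j with j < n.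

open import Defs
open import Data.Nat as ℕ using (ℕ; suc; _≤_)
open import Data.Fin using (Fin)
open import Data.Product using (_×_)
open import Data.Sum using (_⊎_)
open import Relation.Binary.PropositionalEquality using (_≡_)
open import Relation.Nullary using (¬_)

open import Data.Nat using (zero; _<_; _⊔_; z≤n; s≤s)
import Data.Nat.Properties as ℕ
open import Data.Nat.Combinatorics using (nCn≡1; nC1≡n; nCk+nC[k+1]≡[n+1]C[k+1]) renaming (_C_ to _choose_)
open import Data.Nat.Divisibility using (_∣_; divides; ∣⇒≤; m%n≡0⇒n∣m)
open import Data.Nat.Primality using (Prime; prime[2]; prime⇒irreducible; prime⇒nonTrivial; euclidsLemma)
open import Data.Nat.Tactic.RingSolver using (solve-∀)
open import Data.Integer as ℤ using (ℤ; -[1+_]; _⊖_)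
import Data.Integer.Properties as ℤ
open import Data.Sign as Sign using (Sign)
open import Data.Bool using (true; false; if_then_else_)
open import Data.Maybe using (Maybe; just; nothing)
open import Data.Fin as Fin using (zero; suc; inject₁; fromℕ; toℕ)
import Data.Fin.Properties as Fin
open import Data.Fin.Relation.Unary.Top using (view; ‵fromℕ; ‵inject₁)
import Data.Vec.Functional as Vector
open import Data.List using (List; []; _∷_; [_]; _++_; map; concatMap; length; filter; foldr; replicate)
import Data.List.Properties as List
open import Data.List.Membership.Propositional using (_∈_; lose)
import Data.List.Membership.Propositional.Properties as ∈
open import Data.List.Membership.Propositional.Properties.WithK using (unique∧set⇒bag)
open import Data.List.Relation.Binary.BagAndSetEquality using (∼bag⇒↭)
open import Data.List.Relation.Binary.Permutation.Propositional using (_↭_; ↭⇒↭ₛ)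
open import Data.List.Relation.Binary.Permutation.Propositional.Properties using (↭-length; filter-↭)
import Data.List.Relation.Binary.Permutation.Setoid.Properties as Permutationₛ
open import Data.List.Relation.Unary.All as All using (All; []; _∷_)
open import Data.List.Relation.Unary.AllPairs using (_∷_)
open import Data.List.Relation.Unary.Any using (here; there; any?; satisfied)
open import Data.List.Relation.Unary.Unique.Propositional using (Unique)
import Data.List.Relation.Unary.Unique.Propositional.Properties as Unique
open import Data.Product using (Σ; _,_; proj₁; proj₂)
open import Data.Sum using (inj₁; inj₂; [_,_]′)
open import Function using (_∘_; mk⇔)
open import Function.Bundles using (Equivalence)
open import Level using (0ℓ)
open import Algebra.Bundles using (CommutativeRing)
import Algebra.Properties.CommutativeSemiring.Binomial
import Algebra.Solver.Ring
open import Algebra.Solver.Ring.AlmostCommutativeRing using (fromCommutativeRing; _-Raw-AlmostCommutative⟶_)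
open import Relation.Binary.PropositionalEquality using (_≢_; refl; sym; trans; cong; cong₂; subst; subst₂; setoid; module ≡-Reasoning)
open import Relation.Nullary using (Dec; yes; no; contradiction)
open import Relation.Nullary.Decidable using (⌊_⌋; map′; _×-dec_; ¬?)
open import Relation.Unary using (Pred; Decidable; _≐_)
open import Relation.Binary.Definitions using (DecidableEquality)

module Counting where

  open import Data.Nat using (_+_; _*_)
  open import Data.Nat.ListAction using (sum)
  open import Algebra.Properties.CommutativeSemigroup ℕ.+-commutativeSemigroup using (interchange)

  private variable
    A B : Set

  count : {P : Pred A 0ℓ} → Decidable P → List A → ℕ
  count P? xs = length (filter P? xs)

  indicator : {P : Pred A 0ℓ} → Decidable P → A → ℕ
  indicator P? x = count P? [ x ]

  indicator-yes : {P : Pred A 0ℓ} (P? : Decidable P) {x : A} → P x → indicator P? x ≡ 1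
  indicator-yes P? {x} Px with P? x
  ... | yes _ = refl
  ... | no ¬Px = contradiction Px ¬Px

  indicator-no : {P : Pred A 0ℓ} (P? : Decidable P) {x : A} → ¬ P x → indicator P? x ≡ 0
  indicator-no P? {x} ¬Px with P? x
  ... | yes Px = contradiction Px ¬Px
  ... | no _ = refl

  indicator-≡ : {P : Pred A 0ℓ} {Q : Pred B 0ℓ} (P? : Decidable P) (Q? : Decidable Q) {x : A} {y : B} →
    (P x → Q y) → (Q y → P x) → indicator P? x ≡ indicator Q? y
  indicator-≡ P? Q? {x} {y} to from with P? x | Q? y
  ... | yes _ | yes _ = refl
  ... | yes Px | no ¬Qy = contradiction (to Px) ¬Qy
  ... | no ¬Px | yes Qy = contradiction (from Qy) ¬Px
  ... | no _ | no _ = refl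

  count-∷ : {P : Pred A 0ℓ} (P? : Decidable P) (x : A) (xs : List A) → count P? (x ∷ xs) ≡ indicator P? x + count P? xs
  count-∷ P? x xs with P? x
  ... | yes _ = refl
  ... | no _ = refl

  count-++ : {P : Pred A 0ℓ} (P? : Decidable P) (xs ys : List A) → count P? (xs ++ ys) ≡ count P? xs + count P? ys
  count-++ P? xs ys = trans (cong length (List.filter-++ P? xs ys)) (List.length-++ (filter P? xs))

  count-≐ : {P Q : Pred A 0ℓ} (P? : Decidable P) (Q? : Decidable Q) → P ≐ Q → (xs : List A) → count P? xs ≡ count Q? xs
  count-≐ P? Q? P≐Q xs = cong length (List.filter-≐ P? Q? P≐Q xs)

  count-↭ : {P : Pred A 0ℓ} (P? : Decidable P) {xs ys : List A} → xs ↭ ys → count P? xs ≡ count P? ys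
  count-↭ P? = ↭-length ∘ filter-↭ P?

  count-map : {P : Pred A 0ℓ} (P? : Decidable P) (f : B → A) (xs : List B) → count P? (map f xs) ≡ count (P? ∘ f) xs
  count-map P? f [] = refl
  count-map P? f (x ∷ xs) with P? (f x)
  ... | yes _ = cong suc (count-map P? f xs)
  ... | no _ = count-map P? f xs

  count-none : {P : Pred A 0ℓ} (P? : Decidable P) (xs : List A) → (∀ {x} → x ∈ xs → ¬ P x) → count P? xs ≡ 0
  count-none P? xs none = cong length (List.filter-none P? (All.tabulate none))

  count-mono : {P Q : Pred A 0ℓ} (P? : Decidable P) (Q? : Decidable Q) → (∀ {x} → P x → Q x) →
    (xs : List A) → count P? xs ≤ count Q? xs
  count-mono P? Q? P⊆Q [] = z≤n
  count-mono P? Q? P⊆Q (x ∷ xs) with P? x | Q? x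
  ... | yes _ | yes _ = s≤s (count-mono P? Q? P⊆Q xs)
  ... | yes p | no ¬q = contradiction (P⊆Q p) ¬q
  ... | no _ | yes _ = ℕ.m≤n⇒m≤1+n (count-mono P? Q? P⊆Q xs)
  ... | no _ | no _ = count-mono P? Q? P⊆Q xs

  count-split : {P Q : Pred A 0ℓ} (P? : Decidable P) (Q? : Decidable Q) (xs : List A) →
    count P? xs ≡ count (λ x → P? x ×-dec Q? x) xs + count (λ x → P? x ×-dec ¬? (Q? x)) xs
  count-split P? Q? [] = refl
  count-split P? Q? (x ∷ xs) with P? x | Q? x
  ... | yes _ | yes _ = cong suc (count-split P? Q? xs)
  ... | yes _ | no _ = trans (cong suc (count-split P? Q? xs)) (sym (ℕ.+-suc _ _))
  ... | no _ | yes _ = count-split P? Q? xs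
  ... | no _ | no _ = count-split P? Q? xs

  count-unique : {P : Pred A 0ℓ} (P? : Decidable P) {z : A} {xs : List A} → Unique xs → z ∈ xs → P z →
    (∀ {y} → P y → y ≡ z) → count P? xs ≡ 1
  count-unique P? {xs = y ∷ xs} (z∉xs ∷ _) (here refl) Pz only with P? y
  ... | yes _ = cong suc (count-none P? xs λ y∈xs Py → All.lookup z∉xs y∈xs (sym (only Py)))
  ... | no ¬Pz = contradiction Pz ¬Pz
  count-unique P? {xs = y ∷ xs} (y∉xs ∷ u) (there z∈xs) Pz only with P? y
  ... | yes Py = contradiction (only Py) (All.lookup y∉xs z∈xs)
  ... | no _ = count-unique P? u z∈xs Pz only

  length≡count+count∁ : {P : Pred A 0ℓ} (P? : Decidable P) (xs : List A) → length xs ≡ count P? xs + count (¬? ∘ P?) xs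
  length≡count+count∁ P? [] = refl
  length≡count+count∁ P? (x ∷ xs) with P? x
  ... | yes _ = cong suc (length≡count+count∁ P? xs)
  ... | no _ = trans (cong suc (length≡count+count∁ P? xs)) (sym (ℕ.+-suc _ _))

  ∑ : List A → (A → ℕ) → ℕ
  ∑ xs g = sum (map g xs)

  ∑-cong : (xs : List A) {g h : A → ℕ} → (∀ x → g x ≡ h x) → ∑ xs g ≡ ∑ xs h
  ∑-cong xs g≗h = cong sum (List.map-cong g≗h xs)

  ∑-const : (xs : List A) (k : ℕ) → ∑ xs (λ _ → k) ≡ length xs * k
  ∑-const [] k = refl
  ∑-const (x ∷ xs) k = cong (k +_) (∑-const xs k)

  ∑-*ˡ : (xs : List A) (k : ℕ) (g : A → ℕ) → ∑ xs (λ x → k * g x) ≡ k * ∑ xs g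
  ∑-*ˡ [] k g = sym (ℕ.*-zeroʳ k)
  ∑-*ˡ (x ∷ xs) k g = trans (cong (k * g x +_) (∑-*ˡ xs k g)) (sym (ℕ.*-distribˡ-+ k (g x) _))

  ∑-+ : (xs : List A) (g h : A → ℕ) → ∑ xs (λ x → g x + h x) ≡ ∑ xs g + ∑ xs h
  ∑-+ [] g h = refl
  ∑-+ (x ∷ xs) g h = trans (cong (g x + h x +_) (∑-+ xs g h)) (interchange (g x) (h x) _ _)

  ∑-indicator : {P : Pred A 0ℓ} (P? : Decidable P) (xs : List A) → ∑ xs (indicator P?) ≡ count P? xs
  ∑-indicator P? [] = refl
  ∑-indicator P? (x ∷ xs) = trans (cong (indicator P? x +_) (∑-indicator P? xs)) (sym (count-∷ P? x xs))

  count-concatMap : {P : Pred A 0ℓ} (P? : Decidable P) (g : B → List A) (ys : List B) →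
    count P? (concatMap g ys) ≡ ∑ ys (count P? ∘ g)
  count-concatMap P? g [] = refl
  count-concatMap P? g (y ∷ ys) =
    trans (count-++ P? (g y) (concatMap g ys)) (cong (count P? (g y) +_) (count-concatMap P? g ys))

  module _ (_≟_ : DecidableEquality B) {ys : List B} (unique : Unique ys) (complete : ∀ y → y ∈ ys) (f : A → B) where

    ∑-fibres : (xs : List A) → ∑ ys (λ y → count (λ x → f x ≟ y) xs) ≡ length xs
    ∑-fibres [] = trans (∑-const ys 0) (ℕ.*-zeroʳ (length ys))
    ∑-fibres (x ∷ xs) = begin
      ∑ ys (λ y → count (λ x → f x ≟ y) (x ∷ xs))
        ≡⟨ ∑-cong ys (λ y → count-∷ (λ x → f x ≟ y) x xs) ⟩
      ∑ ys (λ y → indicator (λ x → f x ≟ y) x + count (λ x → f x ≟ y) xs)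
        ≡⟨ ∑-+ ys _ _ ⟩
      ∑ ys (λ y → indicator (λ x → f x ≟ y) x) + ∑ ys (λ y → count (λ x → f x ≟ y) xs)
        ≡⟨ cong₂ _+_ fibre-of-x (∑-fibres xs) ⟩
      suc (length xs) ∎
      where
        open ≡-Reasoning
        fibre-of-x : ∑ ys (λ y → indicator (λ x → f x ≟ y) x) ≡ 1
        fibre-of-x = begin
          ∑ ys (λ y → indicator (λ x → f x ≟ y) x)
            ≡⟨ ∑-cong ys (λ y → indicator-≡ (λ x → f x ≟ y) (f x ≟_) (λ e → e) (λ e → e)) ⟩
          ∑ ys (indicator (f x ≟_))
            ≡⟨ ∑-indicator (f x ≟_) ys ⟩
          count (f x ≟_) ys
            ≡⟨ count-unique (f x ≟_) unique (complete (f x)) refl sym ⟩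
          1
            ∎

  unique∧⊆∧⊇⇒↭ : {xs ys : List A} → Unique xs → Unique ys →
    (∀ {z} → z ∈ xs → z ∈ ys) → (∀ {z} → z ∈ ys → z ∈ xs) → xs ↭ ys
  unique∧⊆∧⊇⇒↭ uxs uys xs⊆ys ys⊆xs = ∼bag⇒↭ (unique∧set⇒bag uxs uys (mk⇔ xs⊆ys ys⊆xs))

open Counting

module FieldAlgebra (𝔽 : FiniteField) where

  open FieldDefs 𝔽

  commutativeRing : CommutativeRing 0ℓ 0ℓ
  commutativeRing = record { isCommutativeRing = isCommutativeRing }

  open CommutativeRing commutativeRing public
    using (+-assoc; +-comm; +-identityˡ; +-identityʳ; -‿inverseˡ; -‿inverseʳ;
           *-assoc; *-comm; *-identityˡ; *-identityʳ; zeroˡ; zeroʳ;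
           ring; semiring; commutativeSemiring; +-commutativeSemigroup; +-isCommutativeMonoid; *-isCommutativeMonoid)
  open import Algebra.Properties.Ring ring public
    using (-1*x≈-x; -‿involutive; -‿injective; -0#≈0#; -‿distribˡ-*; -‿distribʳ-*; -‿+-comm)
  open import Algebra.Properties.Semiring.Mult.TCOptimised semiring
    using (×-homo-+; ×1-homo-*) renaming (_×_ to _×′_)
  open import Algebra.Properties.Semiring.Sum semiring public
    using (sum; sum-cong-≗; sum-init-last; ∑-distrib-+; *-distribˡ-sum)
  open import Algebra.Properties.Semiring.Exp semiring public
    using (_^_; ^-homo-*; ^-assocʳ)
  open import Algebra.Properties.CommutativeSemiring.Exp (CommutativeRing.commutativeSemiring commutativeRing) public
    using (^-distrib-*)

  toK : ℕ → K
  toK n = n ×′ 1#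

  toK-* : ∀ m n → toK (m ℕ.* n) ≡ toK m * toK n
  toK-* = ×1-homo-*

  toK-suc : ∀ n → toK (suc n) ≡ toK n + 1#
  toK-suc zero = sym (+-identityˡ 1#)
  toK-suc (suc n) = refl

  -- The ring solver normalises coefficients by computation, which abstract field elements do not
  -- support, so it runs with integer coefficients mapped into K.
  private
    open ≡-Reasoning
    open import Algebra.Properties.CommutativeSemigroup +-commutativeSemigroup using (interchange)

    ℤtoK : ℤ → K
    ℤtoK (ℤ.+ n) = toK n
    ℤtoK -[1+ n ] = - toK (suc n)

    ℤtoK-⊖ : ∀ m n → ℤtoK (m ⊖ n) ≡ toK m - toK n
    ℤtoK-⊖ m zero = sym (trans (cong (toK m +_) -0#≈0#) (+-identityʳ _))
    ℤtoK-⊖ zero (suc n) = sym (+-identityˡ _)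
    ℤtoK-⊖ (suc m) (suc n) = begin
      ℤtoK (suc m ⊖ suc n)                 ≡⟨ cong ℤtoK (ℤ.[1+m]⊖[1+n]≡m⊖n m n) ⟩
      ℤtoK (m ⊖ n)                         ≡⟨ ℤtoK-⊖ m n ⟩
      toK m - toK n                        ≡⟨ +-identityʳ _ ⟨
      (toK m - toK n) + 0#                 ≡⟨ cong ((toK m - toK n) +_) (-‿inverseʳ 1#) ⟨
      (toK m + - toK n) + (1# + - 1#)      ≡⟨ interchange (toK m) (- toK n) 1# (- 1#) ⟩
      (toK m + 1#) + (- toK n + - 1#)      ≡⟨ cong ((toK m + 1#) +_) (-‿+-comm (toK n) 1#) ⟩
      (toK m + 1#) - (toK n + 1#)          ≡⟨ cong₂ _-_ (toK-suc m) (toK-suc n) ⟨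
      toK (suc m) - toK (suc n)            ∎

    ℤtoK-+ : ∀ i j → ℤtoK (i ℤ.+ j) ≡ ℤtoK i + ℤtoK j
    ℤtoK-+ (ℤ.+ m) (ℤ.+ n) = ×-homo-+ 1# m n
    ℤtoK-+ (ℤ.+ m) -[1+ n ] = ℤtoK-⊖ m (suc n)
    ℤtoK-+ -[1+ m ] (ℤ.+ n) = trans (ℤtoK-⊖ n (suc m)) (+-comm _ _)
    ℤtoK-+ -[1+ m ] -[1+ n ] = begin
      - toK (suc (suc (m ℕ.+ n)))          ≡⟨ cong (-_ ∘ toK ∘ suc) (ℕ.+-suc m n) ⟨
      - toK (suc m ℕ.+ suc n)              ≡⟨ cong -_ (×-homo-+ 1# (suc m) (suc n)) ⟩
      - (toK (suc m) + toK (suc n))        ≡⟨ -‿+-comm _ _ ⟨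
      - toK (suc m) + - toK (suc n)        ∎

    signK : Sign → K → K
    signK Sign.+ x = x
    signK Sign.- x = - x

    ℤtoK-◃ : ∀ s n → ℤtoK (s ℤ.◃ n) ≡ signK s (toK n)
    ℤtoK-◃ Sign.+ zero = refl
    ℤtoK-◃ Sign.+ (suc n) = refl
    ℤtoK-◃ Sign.- zero = sym -0#≈0#
    ℤtoK-◃ Sign.- (suc n) = refl

    ℤtoK-* : ∀ i j → ℤtoK (i ℤ.* j) ≡ ℤtoK i * ℤtoK j
    ℤtoK-* (ℤ.+ m) (ℤ.+ n) = trans (cong ℤtoK (ℤ.+◃n≡+n (m ℕ.* n))) (×1-homo-* m n)
    ℤtoK-* (ℤ.+ m) -[1+ n ] = begin
      ℤtoK (Sign.- ℤ.◃ m ℕ.* suc n)       ≡⟨ ℤtoK-◃ Sign.- (m ℕ.* suc n) ⟩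
      - toK (m ℕ.* suc n)                  ≡⟨ cong -_ (×1-homo-* m (suc n)) ⟩
      - (toK m * toK (suc n))              ≡⟨ -‿distribʳ-* _ _ ⟩
      toK m * - toK (suc n)                ∎
    ℤtoK-* -[1+ m ] (ℤ.+ n) = begin
      ℤtoK (Sign.- ℤ.◃ suc m ℕ.* n)       ≡⟨ ℤtoK-◃ Sign.- (suc m ℕ.* n) ⟩
      - toK (suc m ℕ.* n)                  ≡⟨ cong -_ (×1-homo-* (suc m) n) ⟩
      - (toK (suc m) * toK n)              ≡⟨ -‿distribˡ-* _ _ ⟩
      - toK (suc m) * toK n                ∎
    ℤtoK-* -[1+ m ] -[1+ n ] = begin
      toK (suc m ℕ.* suc n)                ≡⟨ ×1-homo-* (suc m) (suc n) ⟩
      toK (suc m) * toK (suc n)            ≡⟨ -‿involutive _ ⟨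
      - - (toK (suc m) * toK (suc n))      ≡⟨ cong -_ (-‿distribˡ-* _ _) ⟩
      - (- toK (suc m) * toK (suc n))      ≡⟨ -‿distribʳ-* _ _ ⟩
      - toK (suc m) * - toK (suc n)        ∎

    ℤtoK-neg : ∀ i → ℤtoK (ℤ.- i) ≡ - ℤtoK i
    ℤtoK-neg (ℤ.+ zero) = sym -0#≈0#
    ℤtoK-neg (ℤ.+ suc n) = refl
    ℤtoK-neg -[1+ n ] = sym (-‿involutive _)

    ℤ⟶K : ℤ.+-*-rawRing -Raw-AlmostCommutative⟶ fromCommutativeRing commutativeRing
    ℤ⟶K = record
      { ⟦_⟧ = ℤtoK
      ; +-homo = ℤtoK-+
      ; *-homo = ℤtoK-*
      ; -‿homo = ℤtoK-neg
      ; 0-homo = refl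
      ; 1-homo = refl
      }

    ℤ-coefficients? : ∀ i j → Maybe (ℤtoK i ≡ ℤtoK j)
    ℤ-coefficients? i j with i ℤ.≟ j
    ... | yes refl = just refl
    ... | no _ = nothing

  open Algebra.Solver.Ring ℤ.+-*-rawRing (fromCommutativeRing commutativeRing) ℤ⟶K ℤ-coefficients? public
    using (solve; _:=_; _:+_; _:*_; _:-_; :-_; con)
  open Algebra.Solver.Ring ℤ.+-*-rawRing (fromCommutativeRing commutativeRing) ℤ⟶K ℤ-coefficients?
    using (Polynomial)

  :0 :1 :2 :4 : ∀ {n} → Polynomial n
  :0 = con (ℤ.+ 0)
  :1 = con (ℤ.+ 1)
  :2 = con (ℤ.+ 2)
  :4 = con (ℤ.+ 4)

  x-y≡0⇒x≡y : ∀ {x y} → x - y ≡ 0# → x ≡ y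
  x-y≡0⇒x≡y {x} {y} x-y≡0 = begin
    x                ≡⟨ solve 2 (λ x y → x := x :- y :+ y) refl x y ⟩
    x - y + y        ≡⟨ cong (_+ y) x-y≡0 ⟩
    0# + y           ≡⟨ +-identityˡ y ⟩
    y                ∎

  x≡y⇒x-y≡0 : ∀ {x y} → x ≡ y → x - y ≡ 0#
  x≡y⇒x-y≡0 {x} refl = -‿inverseʳ x

  x+y≡0⇒x≡-y : ∀ {x y} → x + y ≡ 0# → x ≡ - y
  x+y≡0⇒x≡-y {x} {y} x+y≡0 = x-y≡0⇒x≡y (trans (cong (x +_) (-‿involutive y)) x+y≡0)

  x⁻¹*x≡1 : ∀ {x} → x ≢ 0# → x ⁻¹ * x ≡ 1#
  x⁻¹*x≡1 {x} x≢0 = trans (*-comm _ _) (inverse x x≢0)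

  x*y≡0⇒x≡0∨y≡0 : ∀ {x y} → x * y ≡ 0# → x ≡ 0# ⊎ y ≡ 0#
  x*y≡0⇒x≡0∨y≡0 {x} {y} xy≡0 with x ≟ 0#
  ... | yes x≡0 = inj₁ x≡0
  ... | no x≢0 = inj₂ (begin
    y                ≡⟨ *-identityˡ y ⟨
    1# * y           ≡⟨ cong (_* y) (x⁻¹*x≡1 x≢0) ⟨
    x ⁻¹ * x * y     ≡⟨ *-assoc _ _ _ ⟩
    x ⁻¹ * (x * y)   ≡⟨ cong (x ⁻¹ *_) xy≡0 ⟩
    x ⁻¹ * 0#        ≡⟨ zeroʳ _ ⟩
    0#               ∎)

  x≢0∧y≢0⇒x*y≢0 : ∀ {x y} → x ≢ 0# → y ≢ 0# → x * y ≢ 0#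
  x≢0∧y≢0⇒x*y≢0 x≢0 y≢0 xy≡0 with x*y≡0⇒x≡0∨y≡0 xy≡0
  ... | inj₁ x≡0 = x≢0 x≡0
  ... | inj₂ y≡0 = y≢0 y≡0

  *-cancelˡ : ∀ {x y z} → x ≢ 0# → x * y ≡ x * z → y ≡ z
  *-cancelˡ {x} {y} {z} x≢0 xy≡xz with x*y≡0⇒x≡0∨y≡0 x[y-z]≡0
    where
      x[y-z]≡0 : x * (y - z) ≡ 0#
      x[y-z]≡0 = trans (solve 3 (λ x y z → x :* (y :- z) := x :* y :- x :* z) refl x y z) (x≡y⇒x-y≡0 xy≡xz)
  ... | inj₁ x≡0 = contradiction x≡0 x≢0
  ... | inj₂ y-z≡0 = x-y≡0⇒x≡y y-z≡0

  x⁻¹≢0 : ∀ {x} → x ≢ 0# → x ⁻¹ ≢ 0#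
  x⁻¹≢0 {x} x≢0 x⁻¹≡0 = 0≢1 (trans (sym (zeroʳ x)) (trans (cong (x *_) (sym x⁻¹≡0)) (inverse x x≢0)))

  *-cancel-⁻¹ˡ : ∀ {x} → x ≢ 0# → ∀ y → x ⁻¹ * (x * y) ≡ y
  *-cancel-⁻¹ˡ {x} x≢0 y = trans (sym (*-assoc _ _ _)) (trans (cong (_* y) (x⁻¹*x≡1 x≢0)) (*-identityˡ y))

  *-cancel-⁻¹ʳ : ∀ {x} → x ≢ 0# → ∀ y → x * (x ⁻¹ * y) ≡ y
  *-cancel-⁻¹ʳ {x} x≢0 y = trans (sym (*-assoc _ _ _)) (trans (cong (_* y) (inverse x x≢0)) (*-identityˡ y))

  ^≡^ᴷ : ∀ x n → x ^ n ≡ x ^ᴷ n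
  ^≡^ᴷ x zero = refl
  ^≡^ᴷ x (suc n) = cong (x *_) (^≡^ᴷ x n)

  ^-distribˡ-+-* : ∀ x m n → x ^ᴷ (m ℕ.+ n) ≡ x ^ᴷ m * x ^ᴷ n
  ^-distribˡ-+-* x m n rewrite sym (^≡^ᴷ x (m ℕ.+ n)) | sym (^≡^ᴷ x m) | sym (^≡^ᴷ x n) = ^-homo-* x m n

  ^-*-assoc : ∀ x m n → (x ^ᴷ m) ^ᴷ n ≡ x ^ᴷ (m ℕ.* n)
  ^-*-assoc x m n rewrite sym (^≡^ᴷ (x ^ᴷ m) n) | sym (^≡^ᴷ x (m ℕ.* n)) | sym (^≡^ᴷ x m) = ^-assocʳ x m n

  ^-distribʳ-* : ∀ x y n → (x * y) ^ᴷ n ≡ x ^ᴷ n * y ^ᴷ n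
  ^-distribʳ-* x y n rewrite sym (^≡^ᴷ (x * y) n) | sym (^≡^ᴷ x n) | sym (^≡^ᴷ y n) = ^-distrib-* x y n

  1^n≡1 : ∀ n → 1# ^ᴷ n ≡ 1#
  1^n≡1 zero = refl
  1^n≡1 (suc n) = trans (cong (1# *_) (1^n≡1 n)) (*-identityˡ 1#)

  x^n≢0 : ∀ {x} n → x ≢ 0# → x ^ᴷ n ≢ 0#
  x^n≢0 zero x≢0 1≡0 = 0≢1 (sym 1≡0)
  x^n≢0 (suc n) x≢0 = x≢0∧y≢0⇒x*y≢0 x≢0 (x^n≢0 n x≢0)

  x^n≡0⇒x≡0 : ∀ {x} n → x ^ᴷ n ≡ 0# → x ≡ 0#
  x^n≡0⇒x≡0 {x} n x^n≡0 with x ≟ 0#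
  ... | yes x≡0 = x≡0
  ... | no x≢0 = contradiction x^n≡0 (x^n≢0 n x≢0)

  toK-^ : ∀ m n → toK (m ℕ.^ n) ≡ toK m ^ᴷ n
  toK-^ m zero = refl
  toK-^ m (suc n) = trans (toK-* m (m ℕ.^ n)) (cong (toK m *_) (toK-^ m n))

  ΣF≡sum : ∀ {m} (f : Fin m → K) → ΣF f ≡ sum f
  ΣF≡sum {zero} f = refl
  ΣF≡sum {suc m} f = cong (f zero +_) (ΣF≡sum (f ∘ suc))

  ΣF-cong : ∀ {m} {f g : Fin m → K} → (∀ i → f i ≡ g i) → ΣF f ≡ ΣF g
  ΣF-cong {f = f} {g} f≗g rewrite ΣF≡sum f | ΣF≡sum g = sum-cong-≗ f≗g

  ΣF-zero : ∀ {m} (f : Fin m → K) → (∀ i → f i ≡ 0#) → ΣF f ≡ 0#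
  ΣF-zero {zero} f f≗0 = refl
  ΣF-zero {suc m} f f≗0 = trans (cong₂ _+_ (f≗0 zero) (ΣF-zero (f ∘ suc) (f≗0 ∘ suc))) (+-identityˡ 0#)

  ΣF-init-last : ∀ {m} (f : Fin (suc m) → K) → ΣF f ≡ ΣF (f ∘ inject₁) + f (fromℕ m)
  ΣF-init-last f rewrite ΣF≡sum f | ΣF≡sum (f ∘ inject₁) = sum-init-last f

  ΣF-distrib-+ : ∀ {m} (f g : Fin m → K) → ΣF (λ i → f i + g i) ≡ ΣF f + ΣF g
  ΣF-distrib-+ f g rewrite ΣF≡sum (λ i → f i + g i) | ΣF≡sum f | ΣF≡sum g = ∑-distrib-+ f g

  *-distribˡ-ΣF : ∀ {m} (k : K) (f : Fin m → K) → ΣF (λ i → k * f i) ≡ k * ΣF f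
  *-distribˡ-ΣF k f rewrite ΣF≡sum (λ i → k * f i) | ΣF≡sum f = sym (*-distribˡ-sum k f)

  ΣF-neg : ∀ {m} (f : Fin m → K) → ΣF (λ i → - f i) ≡ - ΣF f
  ΣF-neg f = begin
    ΣF (λ i → - f i)        ≡⟨ ΣF-cong (λ i → -1*x≈-x (f i)) ⟨
    ΣF (λ i → - 1# * f i)   ≡⟨ *-distribˡ-ΣF (- 1#) f ⟩
    - 1# * ΣF f             ≡⟨ -1*x≈-x (ΣF f) ⟩
    - ΣF f                  ∎

  ΣF-distrib-sub : ∀ {m} (f g : Fin m → K) → ΣF (λ i → f i - g i) ≡ ΣF f - ΣF g
  ΣF-distrib-sub f g = trans (ΣF-distrib-+ f (λ i → - g i)) (cong (ΣF f +_) (ΣF-neg g))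

  ΣF-δ : ∀ {m} (v : Fin m → K) (j : Fin m) → ΣF (λ i → v i * δ i j) ≡ v j
  ΣF-δ v zero = trans (cong₂ _+_ (*-identityʳ _) (ΣF-zero _ (λ i → zeroʳ (v (suc i))))) (+-identityʳ _)
  ΣF-δ v (suc j) = trans (cong₂ _+_ (zeroʳ _)
    (trans (ΣF-cong (λ i → cong (v (suc i) *_) (δ-suc i j))) (ΣF-δ (v ∘ suc) j))) (+-identityˡ _)
    where
      δ-suc : ∀ {m} (i j : Fin m) → δ (suc i) (suc j) ≡ δ i j
      δ-suc i j with i Fin.≟ j
      ... | yes _ = refl
      ... | no _ = refl

[k+1]*[n+1]C[k+1]≡[n+1]*nCk : ∀ n k → suc k ℕ.* (suc n choose suc k) ≡ suc n ℕ.* (n choose k)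
[k+1]*[n+1]C[k+1]≡[n+1]*nCk zero zero = refl
[k+1]*[n+1]C[k+1]≡[n+1]*nCk zero (suc k) = ℕ.*-zeroʳ (suc (suc k))
[k+1]*[n+1]C[k+1]≡[n+1]*nCk (suc n) zero = trans (ℕ.*-identityˡ _) (trans (nC1≡n (suc (suc n))) (sym (ℕ.*-identityʳ _)))
[k+1]*[n+1]C[k+1]≡[n+1]*nCk (suc n) (suc k) = begin
  suc (suc k) ℕ.* (suc (suc n) choose suc (suc k))
    ≡⟨ cong (suc (suc k) ℕ.*_) (nCk+nC[k+1]≡[n+1]C[k+1] (suc n) (suc k)) ⟨
  suc (suc k) ℕ.* (a ℕ.+ b)
    ≡⟨ expand (suc k) a b ⟩
  a ℕ.+ suc k ℕ.* a ℕ.+ suc (suc k) ℕ.* b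
    ≡⟨ cong₂ (λ u v → a ℕ.+ u ℕ.+ v) ([k+1]*[n+1]C[k+1]≡[n+1]*nCk n k) ([k+1]*[n+1]C[k+1]≡[n+1]*nCk n (suc k)) ⟩
  a ℕ.+ suc n ℕ.* c ℕ.+ suc n ℕ.* d
    ≡⟨ collect a (suc n) c d ⟩
  a ℕ.+ suc n ℕ.* (c ℕ.+ d)
    ≡⟨ cong (λ t → a ℕ.+ suc n ℕ.* t) (nCk+nC[k+1]≡[n+1]C[k+1] n k) ⟩
  suc (suc n) ℕ.* a
    ∎
  where
    open ≡-Reasoning
    a = suc n choose suc k
    b = suc n choose suc (suc k)
    c = n choose k
    d = n choose suc k
    expand : ∀ k a b → suc k ℕ.* (a ℕ.+ b) ≡ a ℕ.+ k ℕ.* a ℕ.+ suc k ℕ.* b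
    expand = solve-∀
    collect : ∀ a n c d → a ℕ.+ n ℕ.* c ℕ.+ n ℕ.* d ≡ a ℕ.+ n ℕ.* (c ℕ.+ d)
    collect = solve-∀

p∣pC[1+k] : ∀ {p} k → Prime p → suc k < p → p ∣ (p choose suc k)
p∣pC[1+k] {suc n} k p-prime k<n with euclidsLemma (suc k) (suc n choose suc k) p-prime
  (divides (n choose k) (trans ([k+1]*[n+1]C[k+1]≡[n+1]*nCk n k) (ℕ.*-comm (suc n) (n choose k))))
... | inj₁ p∣k+1 = contradiction (∣⇒≤ p∣k+1) (ℕ.<⇒≱ k<n)
... | inj₂ p∣C = p∣C

2≤prime : ∀ {p} → Prime p → 2 ≤ p
2≤prime {p} p-prime = ℕ.nonTrivial⇒n>1 p ⦃ prime⇒nonTrivial p-prime ⦄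

prime∣m^n⇒prime∣m : ∀ {r m} n → Prime r → r ∣ m ℕ.^ n → r ∣ m
prime∣m^n⇒prime∣m zero r-prime r∣1 = contradiction (∣⇒≤ r∣1) (ℕ.<⇒≱ (2≤prime r-prime))
prime∣m^n⇒prime∣m {m = m} (suc n) r-prime r∣m^[1+n] with euclidsLemma m (m ℕ.^ n) r-prime r∣m^[1+n]
... | inj₁ r∣m = r∣m
... | inj₂ r∣m^n = prime∣m^n⇒prime∣m n r-prime r∣m^n

module FiniteFieldArithmetic (𝔽 : FiniteField) where

  open FieldDefs 𝔽
  open FieldAlgebra 𝔽

  open ≡-Reasoning

  sumL : List K → K
  sumL = foldr _+_ 0#

  productL : List K → K
  productL = foldr _*_ 1#

  private
    module P = Permutationₛ (setoid K)

  sumL-↭ : ∀ {xs ys} → xs ↭ ys → sumL xs ≡ sumL ys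
  sumL-↭ = P.foldr-commMonoid +-isCommutativeMonoid ∘ ↭⇒↭ₛ

  productL-↭ : ∀ {xs ys} → xs ↭ ys → productL xs ≡ productL ys
  productL-↭ = P.foldr-commMonoid *-isCommutativeMonoid ∘ ↭⇒↭ₛ

  sumL-map-+ : ∀ x ys → sumL (map (x +_) ys) ≡ toK (length ys) * x + sumL ys
  sumL-map-+ x [] = sym (trans (cong (_+ 0#) (zeroˡ x)) (+-identityʳ 0#))
  sumL-map-+ x (y ∷ ys) = begin
    x + y + sumL (map (x +_) ys)
      ≡⟨ cong (x + y +_) (sumL-map-+ x ys) ⟩
    x + y + (toK (length ys) * x + sumL ys)
      ≡⟨ solve 4 (λ x y n s → x :+ y :+ (n :* x :+ s) := (n :+ :1) :* x :+ (y :+ s)) refl x y (toK (length ys)) (sumL ys) ⟩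
    (toK (length ys) + 1#) * x + (y + sumL ys)
      ≡⟨ cong (λ t → t * x + (y + sumL ys)) (toK-suc (length ys)) ⟨
    toK (suc (length ys)) * x + (y + sumL ys)
      ∎

  productL-map-* : ∀ x ys → productL (map (x *_) ys) ≡ x ^ᴷ length ys * productL ys
  productL-map-* x [] = sym (*-identityˡ 1#)
  productL-map-* x (y ∷ ys) = trans (cong (x * y *_) (productL-map-* x ys))
    (solve 4 (λ x y n s → x :* y :* (n :* s) := x :* n :* (y :* s)) refl x y (x ^ᴷ length ys) (productL ys))

  map-bijection-↭ : (f g : K → K) → (∀ x → g (f x) ≡ x) → (∀ y → f (g y) ≡ y) → map f elements ↭ elements
  map-bijection-↭ f g g∘f≗id f∘g≗id =
    unique∧⊆∧⊇⇒↭ (Unique.map⁺ f-injective unique) unique (λ {z} _ → complete z) (λ {y} _ → f-onto y)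
    where
      f-injective : ∀ {x y} → f x ≡ f y → x ≡ y
      f-injective {x} {y} fx≡fy = trans (sym (g∘f≗id x)) (trans (cong g fx≡fy) (g∘f≗id y))
      f-onto : ∀ y → y ∈ map f elements
      f-onto y = subst (_∈ map f elements) (f∘g≗id y) (∈.∈-map⁺ f (complete (g y)))

  count-bijection : ∀ {P : K → Set} (P? : Decidable P) (f g : K → K) → (∀ x → g (f x) ≡ x) → (∀ y → f (g y) ≡ y) →
    count (P? ∘ f) elements ≡ count P? elements
  count-bijection P? f g g∘f≗id f∘g≗id =
    trans (sym (count-map P? f elements)) (count-↭ P? (map-bijection-↭ f g g∘f≗id f∘g≗id))

  -- Translation by 1 permutes the elements, and shifts their sum by size · 1.
  size·1≡0 : toK size ≡ 0#
  size·1≡0 = begin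
    toK size
      ≡⟨ solve 2 (λ n s → n := n :* :1 :+ s :- s) refl (toK size) (sumL elements) ⟩
    toK size * 1# + sumL elements - sumL elements
      ≡⟨ cong (_- sumL elements) (sumL-map-+ 1# elements) ⟨
    sumL (map (1# +_) elements) - sumL elements
      ≡⟨ cong (_- sumL elements) (sumL-↭ (map-bijection-↭ (1# +_) (_- 1#) 1+x-1≡x x-1+1≡x)) ⟩
    sumL elements - sumL elements
      ≡⟨ -‿inverseʳ _ ⟩
    0#
      ∎
    where
      1+x-1≡x : ∀ x → 1# + x - 1# ≡ x
      1+x-1≡x = solve 1 (λ x → :1 :+ x :- :1 := x) refl
      x-1+1≡x : ∀ x → 1# + (x - 1#) ≡ x
      x-1+1≡x = solve 1 (λ x → :1 :+ (x :- :1) := x) refl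

  size≡p^e⇒p·1≡0 : ∀ {p} e → size ≡ p ℕ.^ e → toK p ≡ 0#
  size≡p^e⇒p·1≡0 {p} e size≡p^e = x^n≡0⇒x≡0 e (trans (sym (toK-^ p e)) (trans (cong toK (sym size≡p^e)) size·1≡0))

  nonzeros : List K
  nonzeros = filter (¬? ∘ (_≟ 0#)) elements

  size≡1+|nonzeros| : size ≡ suc (length nonzeros)
  size≡1+|nonzeros| = trans (length≡count+count∁ (_≟ 0#) elements)
    (cong (ℕ._+ length nonzeros) (count-unique (_≟ 0#) unique (complete 0#) refl (λ x≡0 → x≡0)))

  -- Multiplication by x ≢ 0 permutes the nonzero elements, so x^|K*| · ∏ K* = ∏ K*.
  x^|nonzeros|≡1 : ∀ {x} → x ≢ 0# → x ^ᴷ length nonzeros ≡ 1#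
  x^|nonzeros|≡1 {x} x≢0 = *-cancelˡ ∏≢0 (begin
    productL nonzeros * x ^ᴷ length nonzeros     ≡⟨ *-comm _ _ ⟩
    x ^ᴷ length nonzeros * productL nonzeros     ≡⟨ productL-map-* x nonzeros ⟨
    productL (map (x *_) nonzeros)               ≡⟨ productL-↭ x*-permutes ⟩
    productL nonzeros                            ≡⟨ *-identityʳ _ ⟨
    productL nonzeros * 1#                       ∎)
    where
      nonzero : ∀ {y} → y ∈ nonzeros → y ≢ 0#
      nonzero = proj₂ ∘ ∈.∈-filter⁻ (¬? ∘ (_≟ 0#)) {xs = elements}
      nonzero⁺ : ∀ {y} → y ≢ 0# → y ∈ nonzeros
      nonzero⁺ {y} = ∈.∈-filter⁺ (¬? ∘ (_≟ 0#)) (complete y)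
      ∏≢0 : productL nonzeros ≢ 0#
      ∏≢0 = ∏-nonzero nonzeros (λ y∈ → nonzero y∈)
        where
          ∏-nonzero : ∀ ys → (∀ {y} → y ∈ ys → y ≢ 0#) → productL ys ≢ 0#
          ∏-nonzero [] _ 1≡0 = 0≢1 (sym 1≡0)
          ∏-nonzero (y ∷ ys) ys≢0 = x≢0∧y≢0⇒x*y≢0 (ys≢0 (here refl)) (∏-nonzero ys (ys≢0 ∘ there))
      x*-permutes : map (x *_) nonzeros ↭ nonzeros
      x*-permutes = unique∧⊆∧⊇⇒↭ (Unique.map⁺ (*-cancelˡ x≢0) (Unique.filter⁺ _ unique)) (Unique.filter⁺ _ unique)
        x*-closed x*-onto
        where
          x*-closed : ∀ {z} → z ∈ map (x *_) nonzeros → z ∈ nonzeros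
          x*-closed z∈ with ∈.∈-map⁻ (x *_) z∈
          ... | y , y∈ , refl = nonzero⁺ (x≢0∧y≢0⇒x*y≢0 x≢0 (nonzero y∈))
          x*-onto : ∀ {z} → z ∈ nonzeros → z ∈ map (x *_) nonzeros
          x*-onto {z} z∈ = subst (_∈ map (x *_) nonzeros) (*-cancel-⁻¹ʳ x≢0 z)
            (∈.∈-map⁺ (x *_) (nonzero⁺ (x≢0∧y≢0⇒x*y≢0 (x⁻¹≢0 x≢0) (nonzero z∈))))

  fermat : ∀ x → x ^ᴷ size ≡ x
  fermat x rewrite size≡1+|nonzeros| with x ≟ 0#
  ... | yes refl = zeroˡ _
  ... | no x≢0 = trans (cong (x *_) (x^|nonzeros|≡1 x≢0)) (*-identityʳ x)

  private
    module Binomial = Algebra.Properties.CommutativeSemiring.Binomial commutativeSemiring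
    open import Algebra.Properties.Semiring.Mult semiring using () renaming (_×_ to _×ᵤ_)

    ×ᵤ≡toK* : ∀ n z → n ×ᵤ z ≡ toK n * z
    ×ᵤ≡toK* zero z = sym (zeroˡ z)
    ×ᵤ≡toK* (suc n) z = begin
      z + n ×ᵤ z            ≡⟨ cong (z +_) (×ᵤ≡toK* n z) ⟩
      z + toK n * z         ≡⟨ solve 2 (λ z n → z :+ n :* z := (n :+ :1) :* z) refl z (toK n) ⟩
      (toK n + 1#) * z      ≡⟨ cong (_* z) (toK-suc n) ⟨
      toK (suc n) * z       ∎

  -- In the binomial expansion of (x + y)^p all middle coefficients are divisible by p.
  frobenius-prime : ∀ {p} → Prime p → toK p ≡ 0# → ∀ x y → (x + y) ^ᴷ p ≡ x ^ᴷ p + y ^ᴷ p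
  frobenius-prime {suc (suc n)} p-prime p·1≡0 x y = begin
    (x + y) ^ᴷ p
      ≡⟨ ^≡^ᴷ (x + y) p ⟨
    (x + y) ^ p
      ≡⟨ Binomial.theorem p x y ⟩
    t zero + sum (t ∘ suc)
      ≡⟨ cong (t zero +_) (sum-init-last (t ∘ suc)) ⟩
    t zero + (sum (t ∘ suc ∘ inject₁) + t (fromℕ p))
      ≡⟨ cong₂ (λ u v → t zero + (u + v)) middle≡0 last≡x^p ⟩
    t zero + (0# + x ^ᴷ p)
      ≡⟨ cong₂ _+_ first≡y^p (+-identityˡ _) ⟩
    y ^ᴷ p + x ^ᴷ p
      ≡⟨ +-comm _ _ ⟩
    x ^ᴷ p + y ^ᴷ p
      ∎
    where
      p = suc (suc n)
      t = Binomial.binomialTerm x y p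
      first≡y^p : t zero ≡ y ^ᴷ p
      first≡y^p = begin
        t zero                      ≡⟨ ×ᵤ≡toK* 1 _ ⟩
        1# * (1# * y ^ p)           ≡⟨ trans (*-identityˡ _) (*-identityˡ _) ⟩
        y ^ p                       ≡⟨ ^≡^ᴷ y p ⟩
        y ^ᴷ p                      ∎
      last≡x^p : t (fromℕ p) ≡ x ^ᴷ p
      last≡x^p = begin
        t (fromℕ p)
          ≡⟨ ×ᵤ≡toK* (p choose toℕ (fromℕ p)) (Binomial.binomial x y p (fromℕ p)) ⟩
        toK (p choose toℕ (fromℕ p)) * (x ^ toℕ (fromℕ p) * y ^ (p ℕ.∸ toℕ (fromℕ p)))
          ≡⟨ cong (λ j → toK (p choose j) * (x ^ j * y ^ (p ℕ.∸ j))) (Fin.toℕ-fromℕ p) ⟩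
        toK (p choose p) * (x ^ p * y ^ (p ℕ.∸ p))
          ≡⟨ cong₂ (λ c e → toK c * (x ^ p * y ^ e)) (nCn≡1 p) (ℕ.n∸n≡0 p) ⟩
        1# * (x ^ p * 1#)
          ≡⟨ trans (*-identityˡ _) (*-identityʳ _) ⟩
        x ^ p
          ≡⟨ ^≡^ᴷ x p ⟩
        x ^ᴷ p
          ∎
      p∣C : ∀ i → p ∣ (p choose toℕ (suc (inject₁ i)))
      p∣C i rewrite Fin.toℕ-inject₁ i = p∣pC[1+k] (toℕ i) p-prime (s≤s (Fin.toℕ<n i))
      toK-multiple-of-p : ∀ {m} → p ∣ m → toK m ≡ 0#
      toK-multiple-of-p (divides d refl) = trans (toK-* d p) (trans (cong (toK d *_) p·1≡0) (zeroʳ _))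
      middle≡0 : sum (t ∘ suc ∘ inject₁) ≡ 0#
      middle≡0 = trans (sym (ΣF≡sum (t ∘ suc ∘ inject₁))) (ΣF-zero (t ∘ suc ∘ inject₁) λ i →
        trans (×ᵤ≡toK* (p choose toℕ (suc (inject₁ i))) (Binomial.binomial x y p (suc (inject₁ i))))
              (trans (cong (_* Binomial.binomial x y p (suc (inject₁ i))) (toK-multiple-of-p (p∣C i))) (zeroˡ _)))

  frobenius : ∀ {p} k → Prime p → toK p ≡ 0# → ∀ x y → (x + y) ^ᴷ (p ℕ.^ k) ≡ x ^ᴷ (p ℕ.^ k) + y ^ᴷ (p ℕ.^ k)
  frobenius zero _ _ x y = trans (*-identityʳ (x + y)) (sym (cong₂ _+_ (*-identityʳ x) (*-identityʳ y)))
  frobenius {p} (suc k) p-prime p·1≡0 x y = begin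
    (x + y) ^ᴷ (p ℕ.* p ℕ.^ k)
      ≡⟨ ^-*-assoc (x + y) p (p ℕ.^ k) ⟨
    ((x + y) ^ᴷ p) ^ᴷ (p ℕ.^ k)
      ≡⟨ cong (_^ᴷ (p ℕ.^ k)) (frobenius-prime p-prime p·1≡0 x y) ⟩
    (x ^ᴷ p + y ^ᴷ p) ^ᴷ (p ℕ.^ k)
      ≡⟨ frobenius k p-prime p·1≡0 _ _ ⟩
    (x ^ᴷ p) ^ᴷ (p ℕ.^ k) + (y ^ᴷ p) ^ᴷ (p ℕ.^ k)
      ≡⟨ cong₂ _+_ (^-*-assoc x p (p ℕ.^ k)) (^-*-assoc y p (p ℕ.^ k)) ⟩
    x ^ᴷ (p ℕ.* p ℕ.^ k) + y ^ᴷ (p ℕ.* p ℕ.^ k)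
      ∎

module Polynomial (𝔽 : FiniteField) where

  open FieldDefs 𝔽
  open FieldAlgebra 𝔽

  -- Polynomials are coefficient lists, constant term first.
  eval : List K → K → K
  eval [] x = 0#
  eval (a ∷ p) x = a + x * eval p x

  infixl 6 _⊕_
  _⊕_ : List K → List K → List K
  [] ⊕ r = r
  (a ∷ p) ⊕ [] = a ∷ p
  (a ∷ p) ⊕ (b ∷ r) = a + b ∷ p ⊕ r

  eval-⊕ : ∀ p r x → eval (p ⊕ r) x ≡ eval p x + eval r x
  eval-⊕ [] r x = sym (+-identityˡ _)
  eval-⊕ (a ∷ p) [] x = sym (+-identityʳ _)
  eval-⊕ (a ∷ p) (b ∷ r) x rewrite eval-⊕ p r x =
    solve 5 (λ a b x e f → a :+ b :+ x :* (e :+ f) := a :+ x :* e :+ (b :+ x :* f)) refl a b x (eval p x) (eval r x)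

  length-⊕ : ∀ p r → length (p ⊕ r) ≡ length p ⊔ length r
  length-⊕ [] r = refl
  length-⊕ (a ∷ p) [] = refl
  length-⊕ (a ∷ p) (b ∷ r) = cong suc (length-⊕ p r)

  eval-scale : ∀ k p x → eval (map (k *_) p) x ≡ k * eval p x
  eval-scale k [] x = sym (zeroʳ k)
  eval-scale k (a ∷ p) x rewrite eval-scale k p x =
    solve 4 (λ k a x e → k :* a :+ x :* (k :* e) := k :* (a :+ x :* e)) refl k a x (eval p x)

  quotient : K → List K → List K
  quotient r [] = []
  quotient r (a ∷ p) = p ⊕ map (r *_) (quotient r p)

  length-quotient : ∀ r p → length (quotient r p) ≡ ℕ.pred (length p)
  length-quotient r [] = refl
  length-quotient r (a ∷ p) = begin
    length (p ⊕ map (r *_) (quotient r p))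
      ≡⟨ length-⊕ p _ ⟩
    length p ⊔ length (map (r *_) (quotient r p))
      ≡⟨ cong (length p ⊔_) (trans (List.length-map _ (quotient r p)) (length-quotient r p)) ⟩
    length p ⊔ ℕ.pred (length p)
      ≡⟨ ℕ.m≥n⇒m⊔n≡m ℕ.pred[n]≤n ⟩
    length p
      ∎
    where open ≡-Reasoning

  eval-quotient : ∀ r p x → eval p x ≡ (x - r) * eval (quotient r p) x + eval p r
  eval-quotient r [] x = sym (trans (cong (_+ 0#) (zeroʳ _)) (+-identityʳ _))
  eval-quotient r (a ∷ p) x
    rewrite eval-⊕ p (map (r *_) (quotient r p)) x | eval-scale r (quotient r p) x | eval-quotient r p x =
    solve 5 (λ a x r Q R → a :+ x :* ((x :- r) :* Q :+ R) := (x :- r) :* ((x :- r) :* Q :+ R :+ r :* Q) :+ (a :+ r :* R))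
      refl a x r (eval (quotient r p) x) (eval p r)

  roots<length : ∀ p rs → Unique rs → (∀ {r} → r ∈ rs → eval p r ≡ 0#) → Σ K (λ x → eval p x ≢ 0#) → length rs < length p
  roots<length [] rs _ _ (x , p[x]≢0) = contradiction refl p[x]≢0
  roots<length (a ∷ p) [] _ _ _ = s≤s z≤n
  roots<length (a ∷ p) (r ∷ rs) (r∉rs ∷ rs-unique) roots (x , p[x]≢0) =
    s≤s (subst (length rs <_) (length-quotient r (a ∷ p))
      (roots<length (quotient r (a ∷ p)) rs rs-unique quotient-roots (x , quotient[x]≢0)))
    where
      factor : ∀ y → eval (a ∷ p) y ≡ (y - r) * eval (quotient r (a ∷ p)) y
      factor y = trans (eval-quotient r (a ∷ p) y) (trans (cong ((y - r) * eval (quotient r (a ∷ p)) y +_) (roots (here refl))) (+-identityʳ _))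
      quotient-roots : ∀ {s} → s ∈ rs → eval (quotient r (a ∷ p)) s ≡ 0#
      quotient-roots {s} s∈rs with x*y≡0⇒x≡0∨y≡0 (trans (sym (factor s)) (roots (there s∈rs)))
      ... | inj₁ s-r≡0 = contradiction (sym (x-y≡0⇒x≡y s-r≡0)) (All.lookup r∉rs s∈rs)
      ... | inj₂ q[s]≡0 = q[s]≡0
      quotient[x]≢0 : eval (quotient r (a ∷ p)) x ≢ 0#
      quotient[x]≢0 q[x]≡0 = p[x]≢0 (trans (factor x) (trans (cong ((x - r) *_) q[x]≡0) (zeroʳ _)))

  monomial : ℕ → List K
  monomial k = replicate k 0# ++ [ 1# ]

  eval-monomial : ∀ k x → eval (monomial k) x ≡ x ^ᴷ k
  eval-monomial zero x = trans (cong (1# +_) (zeroʳ x)) (+-identityʳ 1#)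
  eval-monomial (suc k) x = trans (+-identityˡ _) (cong (x *_) (eval-monomial k x))

  length-monomial : ∀ k → length (monomial k) ≡ suc k
  length-monomial k = trans (List.length-++ (replicate k 0#)) (trans (cong (ℕ._+ 1) (List.length-replicate k)) (ℕ.+-comm k 1))

module QuadraticExtension (𝔽 : FiniteField) (q : ℕ) (q-prime-power : IsPrimePower q)
  (size≡q² : FiniteField.size 𝔽 ≡ q ℕ.^ 2) (θ : FiniteField.K 𝔽) (θ∉Fq : ¬ FieldDefs.InSub 𝔽 q θ) where

  open FieldDefs 𝔽
  open FieldAlgebra 𝔽
  open FiniteFieldArithmetic 𝔽
  open Polynomial 𝔽
  open ≡-Reasoning

  private
    p : ℕ
    p = proj₁ q-prime-power
    k : ℕ
    k = proj₁ (proj₂ q-prime-power)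
    p-prime : Prime p
    p-prime = proj₁ (proj₂ (proj₂ q-prime-power))
    1≤k : 1 ≤ k
    1≤k = proj₁ (proj₂ (proj₂ (proj₂ q-prime-power)))
    q≡p^k : q ≡ p ℕ.^ k
    q≡p^k = proj₂ (proj₂ (proj₂ (proj₂ q-prime-power)))

  2≤q : 2 ≤ q
  2≤q = subst (2 ≤_) (sym q≡p^k) (ℕ.≤-trans (ℕ.^-monoʳ-≤ 2 1≤k) (ℕ.^-monoˡ-≤ k (2≤prime p-prime)))

  size≡q*q : size ≡ q ℕ.* q
  size≡q*q = trans size≡q² (cong (q ℕ.*_) (ℕ.*-identityʳ q))

  p·1≡0 : toK p ≡ 0#
  p·1≡0 = size≡p^e⇒p·1≡0 (k ℕ.* 2) (trans size≡q² (trans (cong (ℕ._^ 2) q≡p^k) (ℕ.^-*-assoc p k 2)))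

  even⇒2·1≡0 : IsEven q → toK 2 ≡ 0#
  even⇒2·1≡0 q-even = subst (λ r → toK r ≡ 0#) p≡2 p·1≡0
    where
      2∣p : 2 ∣ p
      2∣p = prime∣m^n⇒prime∣m k prime[2] (subst (2 ∣_) q≡p^k (m%n≡0⇒n∣m q 2 q-even))
      p≡2 : p ≡ 2
      p≡2 with prime⇒irreducible p-prime 2∣p
      ... | inj₂ 2≡p = sym 2≡p

  φ : K → K
  φ x = x ^ᴷ q

  φ-0 : φ 0# ≡ 0#
  φ-0 = 0^q (ℕ.≤-trans (s≤s z≤n) 2≤q)
    where
      0^q : ∀ {n} → 1 ≤ n → 0# ^ᴷ n ≡ 0#
      0^q {suc n} _ = zeroˡ _

  φ-1 : φ 1# ≡ 1#
  φ-1 = 1^n≡1 q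

  φ-+ : ∀ x y → φ (x + y) ≡ φ x + φ y
  φ-+ x y = subst (λ n → (x + y) ^ᴷ n ≡ x ^ᴷ n + y ^ᴷ n) (sym q≡p^k) (frobenius k p-prime p·1≡0 x y)

  φ-* : ∀ x y → φ (x * y) ≡ φ x * φ y
  φ-* x y = ^-distribʳ-* x y q

  φ-neg : ∀ x → φ (- x) ≡ - φ x
  φ-neg x = x+y≡0⇒x≡-y (trans (sym (φ-+ (- x) x)) (trans (cong φ (-‿inverseˡ x)) φ-0))

  φ-sub : ∀ x y → φ (x - y) ≡ φ x - φ y
  φ-sub x y = trans (φ-+ x (- y)) (cong (φ x +_) (φ-neg y))

  φ-involutive : ∀ x → φ (φ x) ≡ x
  φ-involutive x = begin
    (x ^ᴷ q) ^ᴷ q      ≡⟨ ^-*-assoc x q q ⟩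
    x ^ᴷ (q ℕ.* q)     ≡⟨ cong (x ^ᴷ_) size≡q*q ⟨
    x ^ᴷ size          ≡⟨ fermat x ⟩
    x                  ∎

  φ-fixed-⁻¹ : ∀ {x} → x ≢ 0# → φ x ≡ x → φ (x ⁻¹) ≡ x ⁻¹
  φ-fixed-⁻¹ {x} x≢0 φx≡x = *-cancelˡ x≢0 (begin
    x * φ (x ⁻¹)         ≡⟨ cong (_* φ (x ⁻¹)) φx≡x ⟨
    φ x * φ (x ⁻¹)       ≡⟨ φ-* x (x ⁻¹) ⟨
    φ (x * x ⁻¹)         ≡⟨ cong φ (inverse x x≢0) ⟩
    φ 1#                 ≡⟨ φ-1 ⟩
    1#                   ≡⟨ inverse x x≢0 ⟨
    x * x ⁻¹             ∎)

  T : K → K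
  T x = φ x - x

  T-+ : ∀ x y → T (x + y) ≡ T x + T y
  T-+ x y = trans (cong (_- (x + y)) (φ-+ x y))
    (solve 4 (λ a b x y → a :+ b :- (x :+ y) := a :- x :+ (b :- y)) refl (φ x) (φ y) x y)

  TraceZero : K → Set
  TraceZero z = φ z ≡ - z

  traceZero? : Decidable TraceZero
  traceZero? z = φ z ≟ (- z)

  traceZero-T : ∀ x → TraceZero (T x)
  traceZero-T x = trans (φ-sub (φ x) x) (trans (cong (_- φ x) (φ-involutive x))
    (solve 2 (λ x y → x :- y := :- (y :- x)) refl x (φ x)))

  traceZero-0 : TraceZero 0#
  traceZero-0 = trans φ-0 (sym -0#≈0#)

  traceZero-+ : ∀ {z w} → TraceZero z → TraceZero w → TraceZero (z + w)
  traceZero-+ {z} {w} φz≡-z φw≡-w = trans (φ-+ z w) (trans (cong₂ _+_ φz≡-z φw≡-w) (-‿+-comm z w))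

  traceZero-neg : ∀ {z} → TraceZero z → TraceZero (- z)
  traceZero-neg {z} φz≡-z = trans (φ-neg z) (cong -_ φz≡-z)

  traceZero-sub : ∀ {z w} → TraceZero z → TraceZero w → TraceZero (z - w)
  traceZero-sub tz tw = traceZero-+ tz (traceZero-neg tw)

  c : K
  c = T θ

  c≢0 : c ≢ 0#
  c≢0 = θ∉Fq ∘ x-y≡0⇒x≡y

  fibre : K → ℕ
  fibre z = count (λ x → T x ≟ z) elements

  |ker| : ℕ
  |ker| = fibre 0#

  |ker|≤q : |ker| ≤ q
  |ker|≤q = ℕ.≤-pred (subst₂ _<_ refl length-Xq-X
    (roots<length Xq-X (filter (λ x → T x ≟ 0#) elements) (Unique.filter⁺ _ unique)
      (λ r∈ → trans (eval-Xq-X _) (proj₂ (∈.∈-filter⁻ (λ x → T x ≟ 0#) {xs = elements} r∈)))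
      (θ , λ Xq-X[θ]≡0 → c≢0 (trans (sym (eval-Xq-X θ)) Xq-X[θ]≡0))))
    where
      Xq-X : List K
      Xq-X = monomial q ⊕ map (- 1# *_) (monomial 1)
      eval-Xq-X : ∀ x → eval Xq-X x ≡ T x
      eval-Xq-X x = begin
        eval Xq-X x
          ≡⟨ eval-⊕ (monomial q) _ x ⟩
        eval (monomial q) x + eval (map (- 1# *_) (monomial 1)) x
          ≡⟨ cong₂ _+_ (eval-monomial q x) (trans (eval-scale (- 1#) (monomial 1) x) (cong (- 1# *_) (eval-monomial 1 x))) ⟩
        φ x + - 1# * (x * 1#)
          ≡⟨ solve 2 (λ y x → y :+ :- :1 :* (x :* :1) := y :- x) refl (φ x) x ⟩
        T x
          ∎
      length-Xq-X : length Xq-X ≡ suc q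
      length-Xq-X = begin
        length Xq-X
          ≡⟨ length-⊕ (monomial q) _ ⟩
        length (monomial q) ⊔ length (map (- 1# *_) (monomial 1))
          ≡⟨ cong₂ _⊔_ (length-monomial q) (trans (List.length-map (- 1# *_) (monomial 1)) (length-monomial 1)) ⟩
        suc q ⊔ 2
          ≡⟨ ℕ.m≥n⇒m⊔n≡m (s≤s (ℕ.≤-trans (s≤s z≤n) 2≤q)) ⟩
        suc q
          ∎

  fibre-translate : ∀ {x₀ z} → T x₀ ≡ z → fibre z ≡ |ker|
  fibre-translate {x₀} {z} Tx₀≡z = begin
    count (λ x → T x ≟ z) elements
      ≡⟨ count-bijection (λ x → T x ≟ z) (_+ x₀) (_- x₀) x+x₀-x₀≡x x-x₀+x₀≡x ⟨
    count (λ x → T (x + x₀) ≟ z) elements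
      ≡⟨ count-≐ _ _ (T[x+x₀]≡z⇒Tx≡0 , Tx≡0⇒T[x+x₀]≡z) elements ⟩
    count (λ x → T x ≟ 0#) elements
      ∎
    where
      x+x₀-x₀≡x : ∀ x → x + x₀ - x₀ ≡ x
      x+x₀-x₀≡x x = solve 2 (λ x y → x :+ y :- y := x) refl x x₀
      x-x₀+x₀≡x : ∀ x → x - x₀ + x₀ ≡ x
      x-x₀+x₀≡x x = solve 2 (λ x y → x :- y :+ y := x) refl x x₀
      T[x+x₀]≡Tx+z : ∀ x → T (x + x₀) ≡ T x + z
      T[x+x₀]≡Tx+z x = trans (T-+ x x₀) (cong (T x +_) Tx₀≡z)
      T[x+x₀]≡z⇒Tx≡0 : ∀ {x} → T (x + x₀) ≡ z → T x ≡ 0#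
      T[x+x₀]≡z⇒Tx≡0 {x} e = begin
        T x              ≡⟨ solve 2 (λ t z → t := t :+ z :- z) refl (T x) z ⟩
        T x + z - z      ≡⟨ cong (_- z) (trans (sym (T[x+x₀]≡Tx+z x)) e) ⟩
        z - z            ≡⟨ -‿inverseʳ z ⟩
        0#               ∎
      Tx≡0⇒T[x+x₀]≡z : ∀ {x} → T x ≡ 0# → T (x + x₀) ≡ z
      Tx≡0⇒T[x+x₀]≡z {x} e = trans (T[x+x₀]≡Tx+z x) (trans (cong (_+ z) e) (+-identityˡ z))

  -- Multiplication by c = T θ maps the kernel of T onto the trace-zero elements.
  |traceZero|≡|ker| : count traceZero? elements ≡ |ker|
  |traceZero|≡|ker| = begin
    count traceZero? elements
      ≡⟨ count-bijection traceZero? (c *_) (c ⁻¹ *_) (*-cancel-⁻¹ˡ c≢0) (*-cancel-⁻¹ʳ c≢0) ⟨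
    count (traceZero? ∘ (c *_)) elements
      ≡⟨ count-≐ _ _ (traceZero-c*y⇒Ty≡0 , Ty≡0⇒traceZero-c*y) elements ⟩
    count (λ x → T x ≟ 0#) elements
      ∎
    where
      -c≢0 : - c ≢ 0#
      -c≢0 -c≡0 = c≢0 (-‿injective (trans -c≡0 (sym -0#≈0#)))
      φ[c*y]≡-c*φy : ∀ y → φ (c * y) ≡ - c * φ y
      φ[c*y]≡-c*φy y = trans (φ-* c y) (cong (_* φ y) (traceZero-T θ))
      traceZero-c*y⇒Ty≡0 : ∀ {y} → TraceZero (c * y) → T y ≡ 0#
      traceZero-c*y⇒Ty≡0 {y} tz = x≡y⇒x-y≡0 (*-cancelˡ -c≢0
        (trans (sym (φ[c*y]≡-c*φy y)) (trans tz (-‿distribˡ-* c y))))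
      Ty≡0⇒traceZero-c*y : ∀ {y} → T y ≡ 0# → TraceZero (c * y)
      Ty≡0⇒traceZero-c*y {y} Ty≡0 = trans (φ[c*y]≡-c*φy y)
        (trans (cong (- c *_) (x-y≡0⇒x≡y Ty≡0)) (sym (-‿distribˡ-* c y)))

  InImage : K → Set
  InImage z = Σ K λ x → T x ≡ z

  inImage? : Decidable InImage
  inImage? z = map′ satisfied (λ (x , Tx≡z) → lose (complete x) Tx≡z) (any? (λ x → T x ≟ z) elements)

  |image| : ℕ
  |image| = count inImage? elements

  fibre≡|ker|*[inImage] : ∀ z → fibre z ≡ |ker| ℕ.* indicator inImage? z
  fibre≡|ker|*[inImage] z with inImage? z
  ... | yes z∈image@(x₀ , Tx₀≡z) = begin
    fibre z                                   ≡⟨ fibre-translate Tx₀≡z ⟩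
    |ker|                                     ≡⟨ ℕ.*-identityʳ |ker| ⟨
    |ker| ℕ.* 1                               ≡⟨ cong (|ker| ℕ.*_) (indicator-yes inImage? z∈image) ⟨
    |ker| ℕ.* indicator inImage? z            ∎
  ... | no z∉image = begin
    fibre z                                   ≡⟨ count-none _ elements (λ {x} _ Tx≡z → z∉image (x , Tx≡z)) ⟩
    0                                         ≡⟨ ℕ.*-zeroʳ |ker| ⟨
    |ker| ℕ.* 0                               ≡⟨ cong (|ker| ℕ.*_) (indicator-no inImage? z∉image) ⟨
    |ker| ℕ.* indicator inImage? z            ∎

  |ker|*|image|≡q*q : |ker| ℕ.* |image| ≡ q ℕ.* q
  |ker|*|image|≡q*q = begin
    |ker| ℕ.* |image|                                   ≡⟨ cong (|ker| ℕ.*_) (∑-indicator inImage? elements) ⟨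
    |ker| ℕ.* ∑ elements (indicator inImage?)           ≡⟨ ∑-*ˡ elements |ker| (indicator inImage?) ⟨
    ∑ elements (λ z → |ker| ℕ.* indicator inImage? z)   ≡⟨ ∑-cong elements fibre≡|ker|*[inImage] ⟨
    ∑ elements fibre                                    ≡⟨ ∑-fibres _≟_ unique complete T elements ⟩
    size                                                ≡⟨ size≡q*q ⟩
    q ℕ.* q                                             ∎

  image⊆traceZero : ∀ {z} → InImage z → TraceZero z × InImage z
  image⊆traceZero (x , refl) = traceZero-T x , (x , refl)

  |image|≤|ker| : |image| ≤ |ker|
  |image|≤|ker| = subst (|image| ≤_) |traceZero|≡|ker| (count-mono inImage? traceZero? (proj₁ ∘ image⊆traceZero) elements)

  -- |ker| ≤ q, while |ker|² ≥ |ker| · |image| = q².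
  |ker|≡q : |ker| ≡ q
  |ker|≡q = ℕ.≤-antisym |ker|≤q (ℕ.≮⇒≥ λ |ker|<q → ℕ.<⇒≱ (ℕ.*-mono-< |ker|<q |ker|<q)
    (subst (_≤ |ker| ℕ.* |ker|) |ker|*|image|≡q*q (ℕ.*-monoʳ-≤ |ker| |image|≤|ker|)))

  |image|≡q : |image| ≡ q
  |image|≡q = ℕ.*-cancelˡ-≡ |image| q q ⦃ ℕ.>-nonZero (ℕ.≤-trans (s≤s z≤n) 2≤q) ⦄
    (trans (cong (ℕ._* |image|) (sym |ker|≡q)) |ker|*|image|≡q*q)

  -- Both sets have q elements and the image lies inside the trace-zero set.
  traceZero⇒inImage : ∀ {z} → TraceZero z → InImage z
  traceZero⇒inImage {z} tz with inImage? z
  ... | yes z∈image = z∈image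
  ... | no z∉image = contradiction (List.filter-some outside? (lose (complete z) (tz , z∉image))) (ℕ.<-irrefl (sym none-outside))
    where
      outside? : Decidable (λ x → TraceZero x × ¬ InImage x)
      outside? x = traceZero? x ×-dec ¬? (inImage? x)
      none-outside : count outside? elements ≡ 0
      none-outside = ℕ.+-cancelˡ-≡ q _ 0 (begin
        q ℕ.+ count outside? elements
          ≡⟨ cong (ℕ._+ count outside? elements) (sym |image|≡q) ⟩
        |image| ℕ.+ count outside? elements
          ≡⟨ cong (ℕ._+ count outside? elements)
               (count-≐ inImage? (λ x → traceZero? x ×-dec inImage? x) (image⊆traceZero , proj₂) elements) ⟩
        count (λ x → traceZero? x ×-dec inImage? x) elements ℕ.+ count outside? elements
          ≡⟨ count-split traceZero? inImage? elements ⟨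
        count traceZero? elements
          ≡⟨ trans |traceZero|≡|ker| |ker|≡q ⟩
        q
          ≡⟨ ℕ.+-identityʳ q ⟨
        q ℕ.+ 0
          ∎)

  fibre-traceZero : ∀ {z} → TraceZero z → fibre z ≡ q
  fibre-traceZero tz = trans (fibre-translate (proj₂ (traceZero⇒inImage tz))) |ker|≡q

  L : K → K → K
  L w x = w * φ x - φ w * x

  traceZero-L : ∀ w x → TraceZero (L w x)
  traceZero-L w x = begin
    φ (w * φ x - φ w * x)
      ≡⟨ φ-sub (w * φ x) (φ w * x) ⟩
    φ (w * φ x) - φ (φ w * x)
      ≡⟨ cong₂ _-_ (trans (φ-* w (φ x)) (cong (φ w *_) (φ-involutive x)))
          (trans (φ-* (φ w) x) (cong (_* φ x) (φ-involutive w))) ⟩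
    φ w * x - w * φ x
      ≡⟨ solve 4 (λ w W x X → W :* x :- w :* X := :- (w :* X :- W :* x)) refl w (φ w) x (φ x) ⟩
    - (w * φ x - φ w * x)
      ∎

  L-0 : ∀ x → L 0# x ≡ 0#
  L-0 x = trans (cong (λ u → 0# * φ x - u * x) φ-0) (solve 2 (λ X x → :0 :* X :- :0 :* x := :0) refl (φ x) x)

  L-sub : ∀ w w′ x → L (w - w′) x ≡ L w x - L w′ x
  L-sub w w′ x = trans (cong (λ u → (w - w′) * φ x - u * x) (φ-sub w w′))
    (solve 6 (λ w w′ W W′ X x → (w :- w′) :* X :- (W :- W′) :* x := (w :* X :- W :* x) :- (w′ :* X :- W′ :* x))
      refl w w′ (φ w) (φ w′) (φ x) x)

  -- L w (w y) = N · T y with N = w^(q+1) a nonzero element of GF(q).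
  fibre-L : ∀ {w z} → w ≢ 0# → TraceZero z → count (λ x → L w x ≟ z) elements ≡ q
  fibre-L {w} {z} w≢0 tz = begin
    count (λ x → L w x ≟ z) elements
      ≡⟨ count-bijection (λ x → L w x ≟ z) (w *_) (w ⁻¹ *_) (*-cancel-⁻¹ˡ w≢0) (*-cancel-⁻¹ʳ w≢0) ⟨
    count (λ y → L w (w * y) ≟ z) elements
      ≡⟨ count-≐ _ _ (L[wy]≡z⇒Ty≡N⁻¹z , Ty≡N⁻¹z⇒L[wy]≡z) elements ⟩
    fibre (N ⁻¹ * z)
      ≡⟨ fibre-traceZero traceZero-N⁻¹z ⟩
    q
      ∎
    where
      N : K
      N = w * φ w
      N≢0 : N ≢ 0#
      N≢0 = x≢0∧y≢0⇒x*y≢0 w≢0 (x^n≢0 q w≢0)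
      φN≡N : φ N ≡ N
      φN≡N = trans (φ-* w (φ w)) (trans (cong (φ w *_) (φ-involutive w)) (*-comm _ _))
      traceZero-N⁻¹z : TraceZero (N ⁻¹ * z)
      traceZero-N⁻¹z = trans (φ-* (N ⁻¹) z) (trans (cong₂ _*_ (φ-fixed-⁻¹ N≢0 φN≡N) tz) (sym (-‿distribʳ-* _ _)))
      L[wy]≡N*Ty : ∀ y → L w (w * y) ≡ N * T y
      L[wy]≡N*Ty y = trans (cong (λ u → w * u - φ w * (w * y)) (φ-* w y))
        (solve 4 (λ w W Y y → w :* (W :* Y) :- W :* (w :* y) := w :* W :* (Y :- y)) refl w (φ w) (φ y) y)
      L[wy]≡z⇒Ty≡N⁻¹z : ∀ {y} → L w (w * y) ≡ z → T y ≡ N ⁻¹ * z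
      L[wy]≡z⇒Ty≡N⁻¹z {y} e = trans (sym (*-cancel-⁻¹ˡ N≢0 (T y))) (cong (N ⁻¹ *_) (trans (sym (L[wy]≡N*Ty y)) e))
      Ty≡N⁻¹z⇒L[wy]≡z : ∀ {y} → T y ≡ N ⁻¹ * z → L w (w * y) ≡ z
      Ty≡N⁻¹z⇒L[wy]≡z {y} e = trans (L[wy]≡N*Ty y) (trans (cong (N *_) e) (*-cancel-⁻¹ʳ N≢0 z))

  count-allVecs : ∀ m {P : (Fin (suc m) → K) → Set} (P? : Decidable P) →
    count P? (allVecs (suc m)) ≡ ∑ elements (λ x₀ → count (P? ∘ (x₀ Vector.∷_)) (allVecs m))
  count-allVecs m P? = trans (count-concatMap P? _ elements) (∑-cong elements (λ x₀ → count-map P? (x₀ Vector.∷_) (allVecs m)))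

  solutions : (m : ℕ) → (Fin m → K → K) → K → ℕ
  solutions m f t = count (λ y → ΣF (λ j → f j (y j)) ≟ t) (allVecs m)

  solutions-0 : ∀ f t → solutions 0 f t ≡ indicator (0# ≟_) t
  solutions-0 f t with 0# ≟ t
  ... | yes _ = refl
  ... | no _ = refl

  solutions-suc : ∀ m f t → solutions (suc m) f t ≡ ∑ elements (λ x₀ → solutions m (f ∘ suc) (t - f zero x₀))
  solutions-suc m f t = trans (count-allVecs m _) (∑-cong elements λ x₀ → count-≐ _ _
    ((λ e → trans (solve 2 (λ a s → s := a :+ s :- a) refl (f zero x₀) _) (cong (_- f zero x₀) e)) ,
     (λ e → trans (cong (f zero x₀ +_) e) (solve 2 (λ a t → a :+ (t :- a) := t) refl (f zero x₀) t)))
    (allVecs m))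

  solutions-zero-forms : ∀ m (f : Fin m → K → K) → (∀ j x → f j x ≡ 0#) → ∀ t →
    solutions m f t ≡ size ℕ.^ m ℕ.* indicator (0# ≟_) t
  solutions-zero-forms zero f f≡0 t = trans (solutions-0 f t) (sym (ℕ.+-identityʳ _))
  solutions-zero-forms (suc m) f f≡0 t = begin
    solutions (suc m) f t
      ≡⟨ solutions-suc m f t ⟩
    ∑ elements (λ x₀ → solutions m (f ∘ suc) (t - f zero x₀))
      ≡⟨ ∑-cong elements (λ x₀ →
          solutions-zero-forms m (f ∘ suc) (f≡0 ∘ suc) (t - f zero x₀)) ⟩
    ∑ elements (λ x₀ → size ℕ.^ m ℕ.* indicator (0# ≟_) (t - f zero x₀))
      ≡⟨ ∑-cong elements (λ x₀ → cong (λ u → size ℕ.^ m ℕ.* indicator (0# ≟_) u) (t-0≡t x₀)) ⟩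
    ∑ elements (λ _ → size ℕ.^ m ℕ.* indicator (0# ≟_) t)
      ≡⟨ ∑-const elements _ ⟩
    size ℕ.* (size ℕ.^ m ℕ.* indicator (0# ≟_) t)
      ≡⟨ ℕ.*-assoc size (size ℕ.^ m) _ ⟨
    size ℕ.^ suc m ℕ.* indicator (0# ≟_) t
      ∎
    where
      t-0≡t : ∀ x₀ → t - f zero x₀ ≡ t
      t-0≡t x₀ = trans (cong (λ u → t - u) (f≡0 zero x₀)) (trans (cong (t +_) -0#≈0#) (+-identityʳ t))

  -- Peel off the first coordinate: if w vanishes on the others, they are free and L (w zero) takes the value t
  -- exactly q times; otherwise recurse.
  solutions-L : ∀ m (w : Fin m → K) → Σ (Fin m) (λ j → w j ≢ 0#) → ∀ {t} → TraceZero t →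
    q ℕ.* solutions m (L ∘ w) t ≡ size ℕ.^ m
  solutions-L (suc m) w (j , wj≢0) {t} tz with Fin.all? (λ j → w (suc j) ≟ 0#)
  ... | yes rest≡0 = begin
    q ℕ.* solutions (suc m) (L ∘ w) t
      ≡⟨ cong (q ℕ.*_) (solutions-suc m (L ∘ w) t) ⟩
    q ℕ.* ∑ elements (λ x₀ → solutions m (L ∘ w ∘ suc) (t - L (w zero) x₀))
      ≡⟨ cong (q ℕ.*_) (∑-cong elements (λ x₀ →
          solutions-zero-forms m _ (λ j x → trans (cong (λ u → L u x) (rest≡0 j)) (L-0 x)) _)) ⟩
    q ℕ.* ∑ elements (λ x₀ → size ℕ.^ m ℕ.* indicator (0# ≟_) (t - L (w zero) x₀))
      ≡⟨ cong (q ℕ.*_) (∑-*ˡ elements (size ℕ.^ m) _) ⟩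
    q ℕ.* (size ℕ.^ m ℕ.* ∑ elements (λ x₀ → indicator (0# ≟_) (t - L (w zero) x₀)))
      ≡⟨ cong (λ u → q ℕ.* (size ℕ.^ m ℕ.* u)) first-coordinate ⟩
    q ℕ.* (size ℕ.^ m ℕ.* q)
      ≡⟨ rearrange q (size ℕ.^ m) ⟩
    q ℕ.* q ℕ.* size ℕ.^ m
      ≡⟨ cong (ℕ._* size ℕ.^ m) size≡q*q ⟨
    size ℕ.^ suc m
      ∎
    where
      only-nonzero-is-first : ∀ i → w i ≢ 0# → w zero ≢ 0#
      only-nonzero-is-first zero w0≢0 = w0≢0
      only-nonzero-is-first (suc i) wi≢0 = contradiction (rest≡0 i) wi≢0
      w0≢0 : w zero ≢ 0#
      w0≢0 = only-nonzero-is-first j wj≢0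
      same-test : ∀ x₀ → indicator (0# ≟_) (t - L (w zero) x₀) ≡ indicator (λ x₀ → L (w zero) x₀ ≟ t) x₀
      same-test x₀ = indicator-≡ (0# ≟_) (λ x₀ → L (w zero) x₀ ≟ t)
        (λ 0≡t-L → sym (x-y≡0⇒x≡y (sym 0≡t-L))) (λ L≡t → sym (x≡y⇒x-y≡0 (sym L≡t)))
      first-coordinate : ∑ elements (λ x₀ → indicator (0# ≟_) (t - L (w zero) x₀)) ≡ q
      first-coordinate = trans (∑-cong elements same-test) (trans (∑-indicator _ elements) (fibre-L w0≢0 tz))
      rearrange : ∀ q a → q ℕ.* (a ℕ.* q) ≡ q ℕ.* q ℕ.* a
      rearrange = solve-∀
  ... | no rest≢0 with Fin.¬∀⟶∃¬ m _ (λ j → w (suc j) ≟ 0#) rest≢0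
  ...   | (i , wi≢0) = begin
    q ℕ.* solutions (suc m) (L ∘ w) t
      ≡⟨ cong (q ℕ.*_) (solutions-suc m (L ∘ w) t) ⟩
    q ℕ.* ∑ elements (λ x₀ → solutions m (L ∘ w ∘ suc) (t - L (w zero) x₀))
      ≡⟨ ∑-*ˡ elements q _ ⟨
    ∑ elements (λ x₀ → q ℕ.* solutions m (L ∘ w ∘ suc) (t - L (w zero) x₀))
      ≡⟨ ∑-cong elements (λ x₀ →
          solutions-L m (w ∘ suc) (i , wi≢0) (traceZero-sub tz (traceZero-L (w zero) x₀))) ⟩
    ∑ elements (λ _ → size ℕ.^ m)
      ≡⟨ ∑-const elements _ ⟩
    size ℕ.^ suc m
      ∎

  System : (m : ℕ) → (Fin m → K → K) → (Fin m → K → K) → K → K → (Fin (suc m) → K) → Set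
  System m f h s t x = (ΣF (λ j → f j (x (inject₁ j))) ≡ t) × (T (x (fromℕ m)) ≡ s + ΣF (λ j → h j (x (inject₁ j))))

  system? : ∀ m f h s t → Decidable (System m f h s t)
  system? m f h s t x = (ΣF (λ j → f j (x (inject₁ j))) ≟ t) ×-dec (T (x (fromℕ m)) ≟ (s + ΣF (λ j → h j (x (inject₁ j)))))

  -- For each choice of the first m coordinates the last one ranges over a fibre of T above a trace-zero element.
  count-system : ∀ m f h {s} t → (∀ j x → TraceZero (h j x)) → TraceZero s →
    count (system? m f h s t) (allVecs (suc m)) ≡ q ℕ.* solutions m f t
  count-system zero f h {s} t h-traceZero s-traceZero = begin
    count (system? zero f h s t) (allVecs 1)
      ≡⟨ count-allVecs zero (system? zero f h s t) ⟩
    ∑ elements (λ x₀ → indicator (system? zero f h s t ∘ (x₀ Vector.∷_)) (λ ()))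
      ≡⟨ ∑-cong elements (λ x₀ → indicator-≡ (system? zero f h s t ∘ (x₀ Vector.∷_)) (λ x₀ → (0# ≟ t) ×-dec (T x₀ ≟ s))
          (λ (e₁ , e₂) → e₁ , trans e₂ (+-identityʳ s)) (λ (e₁ , e₂) → e₁ , trans e₂ (sym (+-identityʳ s)))) ⟩
    ∑ elements (indicator (λ x₀ → (0# ≟ t) ×-dec (T x₀ ≟ s)))
      ≡⟨ ∑-indicator _ elements ⟩
    count (λ x₀ → (0# ≟ t) ×-dec (T x₀ ≟ s)) elements
      ≡⟨ by-cases (0# ≟ t) ⟩
    q ℕ.* indicator (0# ≟_) t
      ≡⟨ cong (q ℕ.*_) (solutions-0 f t) ⟨
    q ℕ.* solutions zero f t
      ∎
    where
      by-cases : (d : Dec (0# ≡ t)) → count (λ x₀ → d ×-dec (T x₀ ≟ s)) elements ≡ q ℕ.* indicator (0# ≟_) t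
      by-cases (yes 0≡t) = begin
        count (λ x₀ → yes 0≡t ×-dec (T x₀ ≟ s)) elements
          ≡⟨ count-≐ _ (λ x₀ → T x₀ ≟ s) (proj₂ , (0≡t ,_)) elements ⟩
        fibre s
          ≡⟨ fibre-traceZero s-traceZero ⟩
        q
          ≡⟨ ℕ.*-identityʳ q ⟨
        q ℕ.* 1
          ≡⟨ cong (q ℕ.*_) (indicator-yes (0# ≟_) 0≡t) ⟨
        q ℕ.* indicator (0# ≟_) t
          ∎
      by-cases (no 0≢t) = begin
        count (λ x₀ → no 0≢t ×-dec (T x₀ ≟ s)) elements        ≡⟨ count-none _ elements (λ _ → 0≢t ∘ proj₁) ⟩
        0                                                    ≡⟨ ℕ.*-zeroʳ q ⟨
        q ℕ.* 0                                              ≡⟨ cong (q ℕ.*_) (indicator-no (0# ≟_) 0≢t) ⟨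
        q ℕ.* indicator (0# ≟_) t                            ∎
  count-system (suc m) f h {s} t h-traceZero s-traceZero = begin
    count (system? (suc m) f h s t) (allVecs (suc (suc m)))
      ≡⟨ count-allVecs (suc m) _ ⟩
    ∑ elements (λ x₀ → count (system? (suc m) f h s t ∘ (x₀ Vector.∷_)) (allVecs (suc m)))
      ≡⟨ ∑-cong elements (λ x₀ → count-≐ _ (system? m (f ∘ suc) (h ∘ suc) (s + h zero x₀) (t - f zero x₀))
                                         ((λ {v} → peel x₀ {v}) , (λ {v} → unpeel x₀ {v})) (allVecs (suc m))) ⟩
    ∑ elements (λ x₀ → count (system? m (f ∘ suc) (h ∘ suc) (s + h zero x₀) (t - f zero x₀)) (allVecs (suc m)))
      ≡⟨ ∑-cong elements (λ x₀ → count-system m (f ∘ suc) (h ∘ suc) (t - f zero x₀) (h-traceZero ∘ suc)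
                                  (traceZero-+ s-traceZero (h-traceZero zero x₀))) ⟩
    ∑ elements (λ x₀ → q ℕ.* solutions m (f ∘ suc) (t - f zero x₀))
      ≡⟨ ∑-*ˡ elements q _ ⟩
    q ℕ.* ∑ elements (λ x₀ → solutions m (f ∘ suc) (t - f zero x₀))
      ≡⟨ cong (q ℕ.*_) (solutions-suc m f t) ⟨
    q ℕ.* solutions (suc m) f t
      ∎
    where
      peel : ∀ x₀ {v} → System (suc m) f h s t (x₀ Vector.∷ v) → System m (f ∘ suc) (h ∘ suc) (s + h zero x₀) (t - f zero x₀) v
      peel x₀ (e₁ , e₂) = trans (solve 2 (λ a s → s := a :+ s :- a) refl (f zero x₀) _) (cong (_- f zero x₀) e₁)
                       , trans e₂ (sym (+-assoc _ _ _))
      unpeel : ∀ x₀ {v} → System m (f ∘ suc) (h ∘ suc) (s + h zero x₀) (t - f zero x₀) v → System (suc m) f h s t (x₀ Vector.∷ v)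
      unpeel x₀ (e₁ , e₂) = trans (cong (f zero x₀ +_) e₁) (solve 2 (λ a t → a :+ (t :- a) := t) refl (f zero x₀) t)
                         , trans e₂ (+-assoc _ _ _)

⌊≤?⌋≡true : ∀ {m n} → m ≤ n → ⌊ m ℕ.≤? n ⌋ ≡ true
⌊≤?⌋≡true {m} {n} m≤n with m ℕ.≤? n
... | yes _ = refl
... | no m≰n = contradiction m≤n m≰n

⌊≤?⌋≡false : ∀ {m n} → ¬ m ≤ n → ⌊ m ℕ.≤? n ⌋ ≡ false
⌊≤?⌋≡false {m} {n} m≰n with m ℕ.≤? n
... | yes m≤n = contradiction m≤n m≰n
... | no _ = refl

module Variety (𝔽 : FiniteField) (q : ℕ) (q-prime-power : IsPrimePower q)
  (size≡q² : FiniteField.size 𝔽 ≡ q ℕ.^ 2) (b : FiniteField.K 𝔽) (b∉Fq : ¬ FieldDefs.InSub 𝔽 q b)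
  (a : FiniteField.K 𝔽) (C : FiniteField.K 𝔽 → Set) where

  open FieldDefs 𝔽
  open FieldAlgebra 𝔽
  open QuadraticExtension 𝔽 q q-prime-power size≡q² b b∉Fq
  open ≡-Reasoning

  ΣMid≡ΣF : ∀ m (g : Fin (suc (suc m)) → K) → ΣMid (suc m) g ≡ ΣF {m} (λ j → g (suc (inject₁ j)))
  ΣMid≡ΣF m g = begin
    0# + ΣF (λ i → if isMid (suc m) (suc i) then g (suc i) else 0#)
      ≡⟨ +-identityˡ _ ⟩
    ΣF (λ i → if isMid (suc m) (suc i) then g (suc i) else 0#)
      ≡⟨ ΣF-init-last (λ i → if isMid (suc m) (suc i) then g (suc i) else 0#) ⟩
    ΣF (λ j → if isMid (suc m) (suc (inject₁ j)) then g (suc (inject₁ j)) else 0#)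
      + (if isMid (suc m) (suc (fromℕ m)) then g (suc (fromℕ m)) else 0#)
      ≡⟨ cong₂ _+_ (ΣF-cong (λ j → cong (λ β → if β then g (suc (inject₁ j)) else 0#) (inner j)))
                   (cong (λ β → if β then g (suc (fromℕ m)) else 0#) last) ⟩
    ΣF (λ j → g (suc (inject₁ j))) + 0#
      ≡⟨ +-identityʳ _ ⟩
    ΣF (λ j → g (suc (inject₁ j)))
      ∎
    where
      inner : ∀ j → isMid (suc m) (suc (inject₁ j)) ≡ true
      inner j = ⌊≤?⌋≡true (s≤s (subst (_< m) (sym (Fin.toℕ-inject₁ j)) (Fin.toℕ<n j)))
      last : isMid (suc m) (suc (fromℕ m)) ≡ false
      last = ⌊≤?⌋≡false (λ m+2≤m+1 → ℕ.<-irrefl (Fin.toℕ-fromℕ m) (ℕ.≤-pred m+2≤m+1))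

  Q : K → K
  Q y = a ^ᴷ q * y ^ᴷ (2 ℕ.* q) - a * y ^ᴷ 2 - c * y ^ᴷ (q ℕ.+ 1)

  ΣF-Q : ∀ {m} (y : Fin m → K) → ΣF (λ j → Q (y j)) ≡
    a ^ᴷ q * ΣF (λ j → y j ^ᴷ (2 ℕ.* q)) - a * ΣF (λ j → y j ^ᴷ 2) - c * ΣF (λ j → y j ^ᴷ (q ℕ.+ 1))
  ΣF-Q y = begin
    ΣF (λ j → a ^ᴷ q * y j ^ᴷ (2 ℕ.* q) - a * y j ^ᴷ 2 - c * y j ^ᴷ (q ℕ.+ 1))
      ≡⟨ ΣF-distrib-sub (λ j → a ^ᴷ q * y j ^ᴷ (2 ℕ.* q) - a * y j ^ᴷ 2) (λ j → c * y j ^ᴷ (q ℕ.+ 1)) ⟩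
    ΣF (λ j → a ^ᴷ q * y j ^ᴷ (2 ℕ.* q) - a * y j ^ᴷ 2) - ΣF (λ j → c * y j ^ᴷ (q ℕ.+ 1))
      ≡⟨ cong₂ _-_ (ΣF-distrib-sub (λ j → a ^ᴷ q * y j ^ᴷ (2 ℕ.* q)) (λ j → a * y j ^ᴷ 2))
                   (*-distribˡ-ΣF c (λ j → y j ^ᴷ (q ℕ.+ 1))) ⟩
    ΣF (λ j → a ^ᴷ q * y j ^ᴷ (2 ℕ.* q)) - ΣF (λ j → a * y j ^ᴷ 2) - c * ΣF (λ j → y j ^ᴷ (q ℕ.+ 1))
      ≡⟨ cong₂ (λ u v → u - v - c * ΣF (λ j → y j ^ᴷ (q ℕ.+ 1)))
               (*-distribˡ-ΣF (a ^ᴷ q) (λ j → y j ^ᴷ (2 ℕ.* q))) (*-distribˡ-ΣF a (λ j → y j ^ᴷ 2)) ⟩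
    a ^ᴷ q * ΣF (λ j → y j ^ᴷ (2 ℕ.* q)) - a * ΣF (λ j → y j ^ᴷ 2) - c * ΣF (λ j → y j ^ᴷ (q ℕ.+ 1))
      ∎

  Fform-affine : ∀ m (X : Point (suc m)) → X zero ≡ 1# →
    Fform (suc m) q a b X ≡ T (X (fromℕ (suc m))) + ΣF {m} (λ j → Q (X (suc (inject₁ j))))
  Fform-affine m X X₀≡1
    rewrite X₀≡1 | 1^n≡1 q | 1^n≡1 (2 ℕ.* q ℕ.∸ 1) | 1^n≡1 (2 ℕ.* q ℕ.∸ 2) | 1^n≡1 (q ℕ.∸ 1)
          | ΣMid≡ΣF m (λ j → X j ^ᴷ (2 ℕ.* q)) | ΣMid≡ΣF m (λ j → X j ^ᴷ 2) | ΣMid≡ΣF m (λ j → X j ^ᴷ (q ℕ.+ 1))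
          | ΣF-Q (λ j → X (suc (inject₁ j))) =
    solve 8 (λ P x A a c S₁ S₂ S₃ → :1 :* P :- x :* :1 :+ A :* S₁ :- a :* S₂ :* :1 :- c :* S₃ :* :1
                                   := P :- x :+ (A :* S₁ :- a :* S₂ :- c :* S₃))
      refl (φ (X (fromℕ (suc m)))) (X (fromℕ (suc m))) (a ^ᴷ q) a c _ _ _

  y^[2q]≡φy*φy : ∀ y → y ^ᴷ (2 ℕ.* q) ≡ φ y * φ y
  y^[2q]≡φy*φy y = trans (^-distribˡ-+-* y q (q ℕ.+ 0)) (cong (φ y *_) (cong (y ^ᴷ_) (ℕ.+-identityʳ q)))

  Q≡ : ∀ y → Q y ≡ φ a * (φ y * φ y) - a * (y * y) - c * (φ y * y)
  Q≡ y rewrite y^[2q]≡φy*φy y | ^-distribˡ-+-* y q 1 | *-identityʳ y = refl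

  traceZero-Q : ∀ y → TraceZero (Q y)
  traceZero-Q y = begin
    φ (Q y)
      ≡⟨ cong φ (Q≡ y) ⟩
    φ (φ a * (φ y * φ y) - a * (y * y) - c * (φ y * y))
      ≡⟨ trans (φ-sub _ _) (cong₂ _-_ (φ-sub _ _) (φ-* c _)) ⟩
    φ (φ a * (φ y * φ y)) - φ (a * (y * y)) - φ c * φ (φ y * y)
      ≡⟨ cong₂ (λ u v → u - v - φ c * φ (φ y * y))
           (trans (φ-* (φ a) _) (cong₂ _*_ (φ-involutive a) (trans (φ-* (φ y) (φ y)) (cong₂ _*_ (φ-involutive y) (φ-involutive y)))))
           (trans (φ-* a _) (cong (φ a *_) (φ-* y y))) ⟩
    a * (y * y) - φ a * (φ y * φ y) - φ c * φ (φ y * y)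
      ≡⟨ cong (λ u → a * (y * y) - φ a * (φ y * φ y) - u)
           (cong₂ _*_ (traceZero-T b) (trans (φ-* (φ y) y) (cong (_* φ y) (φ-involutive y)))) ⟩
    a * (y * y) - φ a * (φ y * φ y) - (- c) * (y * φ y)
      ≡⟨ solve 5 (λ a A y Y c → a :* (y :* y) :- A :* (Y :* Y) :- (:- c) :* (y :* Y)
          := :- (A :* (Y :* Y) :- a :* (y :* y) :- c :* (Y :* y))) refl a (φ a) y (φ y) c ⟩
    - (φ a * (φ y * φ y) - a * (y * y) - c * (φ y * y))
      ≡⟨ cong -_ (Q≡ y) ⟨
    - Q y
      ∎

  u : K → K
  u γ = toK 2 * φ a * φ γ - c * γ

  φ∘u : ∀ γ → φ (u γ) ≡ toK 2 * a * γ + c * φ γ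
  φ∘u γ = begin
    φ (toK 2 * φ a * φ γ - c * γ)
      ≡⟨ φ-sub _ _ ⟩
    φ (toK 2 * φ a * φ γ) - φ (c * γ)
      ≡⟨ cong₂ _-_ (trans (φ-* _ (φ γ)) (cong₂ _*_ (trans (φ-* (toK 2) (φ a)) (cong₂ _*_ φ-2 (φ-involutive a))) (φ-involutive γ)))
          (trans (φ-* c γ) (cong (_* φ γ) (traceZero-T b))) ⟩
    toK 2 * a * γ - (- c) * φ γ
      ≡⟨ solve 4 (λ a g G c → :2 :* a :* g :- (:- c) :* G := :2 :* a :* g :+ c :* G) refl a γ (φ γ) c ⟩
    toK 2 * a * γ + c * φ γ
      ∎
    where
      φ-2 : φ (toK 2) ≡ toK 2
      φ-2 = trans (φ-+ 1# 1#) (cong₂ _+_ φ-1 φ-1)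

  Q-split : ∀ α y → Q (α + y) ≡ Q α + Q y + L (u α) y
  Q-split α y = begin
    Q (α + y)
      ≡⟨ Q≡ (α + y) ⟩
    φ a * (φ (α + y) * φ (α + y)) - a * ((α + y) * (α + y)) - c * (φ (α + y) * (α + y))
      ≡⟨ cong (λ t → φ a * (t * t) - a * ((α + y) * (α + y)) - c * (t * (α + y))) (φ-+ α y) ⟩
    φ a * ((φ α + φ y) * (φ α + φ y)) - a * ((α + y) * (α + y)) - c * ((φ α + φ y) * (α + y))
      ≡⟨ solve 7 (λ A a c α G y Y →
             A :* ((G :+ Y) :* (G :+ Y)) :- a :* ((α :+ y) :* (α :+ y)) :- c :* ((G :+ Y) :* (α :+ y))
          := (A :* (G :* G) :- a :* (α :* α) :- c :* (G :* α)) :+ (A :* (Y :* Y) :- a :* (y :* y) :- c :* (Y :* y))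
             :+ ((:2 :* A :* G :- c :* α) :* Y :- (:2 :* a :* α :+ c :* G) :* y))
           refl (φ a) a c α (φ α) y (φ y) ⟩
    (φ a * (φ α * φ α) - a * (α * α) - c * (φ α * α)) + (φ a * (φ y * φ y) - a * (y * y) - c * (φ y * y))
      + (u α * φ y - (toK 2 * a * α + c * φ α) * y)
      ≡⟨ cong₂ (λ s t → s + t + (u α * φ y - (toK 2 * a * α + c * φ α) * y)) (Q≡ α) (Q≡ y) ⟨
    Q α + Q y + (u α * φ y - (toK 2 * a * α + c * φ α) * y)
      ≡⟨ cong (λ w → Q α + Q y + (u α * φ y - w * y)) (φ∘u α) ⟨
    Q α + Q y + L (u α) y
      ∎

  u-sub : ∀ γ γ′ → u γ - u γ′ ≡ u (γ - γ′)
  u-sub γ γ′ = begin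
    u γ - u γ′
      ≡⟨ solve 6 (λ A G G′ c g g′ → :2 :* A :* G :- c :* g :- (:2 :* A :* G′ :- c :* g′) := :2 :* A :* (G :- G′) :- c :* (g :- g′))
           refl (φ a) (φ γ) (φ γ′) c γ γ′ ⟩
    toK 2 * φ a * (φ γ - φ γ′) - c * (γ - γ′)
      ≡⟨ cong (λ w → toK 2 * φ a * w - c * (γ - γ′)) (φ-sub γ γ′) ⟨
    u (γ - γ′)
      ∎

  D : K
  D = 4# * a ^ᴷ suc q + c * c

  -- From u γ = 0 and its conjugate, D · γ^(q+1) = (2 a^q γ^q)(2 a γ) + c² γ^(q+1) = 0.
  u-injective : D ≢ 0# → ∀ {γ} → u γ ≡ 0# → γ ≡ 0#
  u-injective D≢0 {γ} uγ≡0 with x*y≡0⇒x≡0∨y≡0 D*γ^[q+1]≡0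
    where
      2a^qγ^q≡cγ : toK 2 * φ a * φ γ ≡ c * γ
      2a^qγ^q≡cγ = x-y≡0⇒x≡y uγ≡0
      2aγ≡-cγ^q : toK 2 * a * γ ≡ - (c * φ γ)
      2aγ≡-cγ^q = x+y≡0⇒x≡-y (trans (sym (φ∘u γ)) (trans (cong φ uγ≡0) φ-0))
      D*γ^[q+1]≡0 : D * (γ * φ γ) ≡ 0#
      D*γ^[q+1]≡0 = begin
        D * (γ * φ γ)
          ≡⟨ solve 5 (λ a A c g G → (:4 :* (a :* A) :+ c :* c) :* (g :* G)
              := (:2 :* A :* G) :* (:2 :* a :* g) :+ c :* c :* (g :* G)) refl a (φ a) c γ (φ γ) ⟩
        toK 2 * φ a * φ γ * (toK 2 * a * γ) + c * c * (γ * φ γ)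
          ≡⟨ cong₂ (λ s t → s * t + c * c * (γ * φ γ)) 2a^qγ^q≡cγ 2aγ≡-cγ^q ⟩
        c * γ * - (c * φ γ) + c * c * (γ * φ γ)
          ≡⟨ solve 3 (λ c g G → c :* g :* (:- (c :* G)) :+ c :* c :* (g :* G) := :0) refl c γ (φ γ) ⟩
        0#
          ∎
  ... | inj₁ D≡0 = contradiction D≡0 D≢0
  ... | inj₂ γγ^q≡0 with x*y≡0⇒x≡0∨y≡0 γγ^q≡0
  ...   | inj₁ γ≡0 = γ≡0
  ...   | inj₂ γ^q≡0 = x^n≡0⇒x≡0 q γ^q≡0

  even⇒D≢0 : IsEven q → D ≢ 0#
  even⇒D≢0 q-even D≡0 = c≢0 (x^n≡0⇒x≡0 2 (trans (cong (c *_) (*-identityʳ c)) (begin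
    c * c                        ≡⟨ +-identityˡ _ ⟨
    0# + c * c                   ≡⟨ cong (_+ c * c) (zeroˡ _) ⟨
    0# * a ^ᴷ suc q + c * c      ≡⟨ cong (λ t → t * a ^ᴷ suc q + c * c) 4≡0 ⟨
    D                            ≡⟨ D≡0 ⟩
    0#                           ∎)))
    where
      4≡0 : 4# ≡ 0#
      4≡0 = trans (toK-* 2 2) (trans (cong (_* toK 2) (even⇒2·1≡0 q-even)) (zeroˡ _))

  nonsquare⇒D≢0 : NonSquareInSub q D → D ≢ 0#
  nonsquare⇒D≢0 D-nonsquare D≡0 = D-nonsquare (0# , φ-0 , trans (zeroˡ 0#) (sym D≡0))

  module _ {m : ℕ} where

    αmid : Matrix (suc m) → Fin m → K
    αmid M j = M zero (suc (inject₁ j))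

    αlast : Matrix (suc m) → K
    αlast M = M zero (fromℕ (suc m))

    F^ : Matrix (suc m) → Form (suc m)
    F^ M = Fform (suc m) q a b ^[ M ]

    affine : (Fin (suc m) → K) → Point (suc m)
    affine x = 1# Vector.∷ x

    zero? : (M : Matrix (suc m)) → Decidable (λ x → F^ M (affine x) ≡ 0#)
    zero? M x = F^ M (affine x) ≟ 0#

    translate : ∀ (M : Matrix (suc m)) → (∀ i j → M (suc i) j ≡ δ (suc i) j) →
      ∀ x j → (affine x ·ᴹ M) j ≡ M zero j + (0# Vector.∷ x) j
    translate M rows x j = cong₂ _+_ (*-identityˡ _) (begin
      ΣF (λ i → x i * M (suc i) j)                  ≡⟨ ΣF-cong (λ i → cong (x i *_) (rows i j)) ⟩
      ΣF (λ i → x i * δ (suc i) j)                  ≡⟨ +-identityˡ _ ⟨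
      0# + ΣF (λ i → x i * δ (suc i) j)             ≡⟨ cong (_+ ΣF (λ i → x i * δ (suc i) j)) (zeroˡ _) ⟨
      0# * δ zero j + ΣF (λ i → x i * δ (suc i) j)  ≡⟨ ΣF-δ (0# Vector.∷ x) j ⟩
      (0# Vector.∷ x) j                             ∎)

    F^-affine : ∀ M → InR (suc m) q a b C M → ∀ x →
      F^ M (affine x) ≡ T (αlast M + x (fromℕ m)) + ΣF (λ j → Q (αmid M j + x (inject₁ j)))
    F^-affine M (M₀₀≡1 , rows , _ , _) x = begin
      Fform (suc m) q a b (affine x ·ᴹ M)
        ≡⟨ Fform-affine m (affine x ·ᴹ M) (trans (translate M rows x zero) (trans (cong (_+ 0#) M₀₀≡1) (+-identityʳ 1#))) ⟩
      T ((affine x ·ᴹ M) (fromℕ (suc m))) + ΣF (λ j → Q ((affine x ·ᴹ M) (suc (inject₁ j))))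
        ≡⟨ cong₂ _+_ (cong T (translate M rows x (fromℕ (suc m)))) (ΣF-cong (λ j → cong Q (translate M rows x (suc (inject₁ j))))) ⟩
      T (αlast M + x (fromℕ m)) + ΣF (λ j → Q (αmid M j + x (inject₁ j)))
        ∎

    InR-equation : ∀ M → InR (suc m) q a b C M → T (αlast M) + ΣF (Q ∘ αmid M) ≡ 0#
    InR-equation M (_ , _ , _ , equation)
      rewrite ΣF-Q (αmid M) | sym (ΣMid≡ΣF m (λ j → M zero j ^ᴷ (2 ℕ.* q)))
            | sym (ΣMid≡ΣF m (λ j → M zero j ^ᴷ 2)) | sym (ΣMid≡ΣF m (λ j → M zero j ^ᴷ (q ℕ.+ 1))) =
      trans (solve 8 (λ P x A a c S₁ S₂ S₃ → P :- x :+ (A :* S₁ :- a :* S₂ :- c :* S₃) := (P :- x :+ A :* S₁ :- a :* S₂) :- c :* S₃)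
               refl (φ (αlast M)) (αlast M) (a ^ᴷ q) a c (Σα^ (2 ℕ.* q)) (Σα^ 2) (Σα^ (q ℕ.+ 1)))
            (trans (cong (_- c * Σα^ (q ℕ.+ 1)) equation) (-‿inverseʳ _))
      where
        Σα^ : ℕ → K
        Σα^ e = ΣMid (suc m) (λ j → M zero j ^ᴷ e)

    h : Matrix (suc m) → Fin m → K → K
    h M j y = - (Q y + L (u (αmid M j)) y)

    traceZero-h : ∀ M j y → TraceZero (h M j y)
    traceZero-h M j y = traceZero-neg (traceZero-+ (traceZero-Q y) (traceZero-L (u (αmid M j)) y))

    -- The constant T(α_n) + Σ Q(α_j) vanishes because M ∈ 𝓡.
    F^≡T-Σh : ∀ M → InR (suc m) q a b C M → ∀ x →
      F^ M (affine x) ≡ T (x (fromℕ m)) - ΣF (λ j → h M j (x (inject₁ j)))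
    F^≡T-Σh M M∈R x = begin
      F^ M (affine x)
        ≡⟨ F^-affine M M∈R x ⟩
      T (αlast M + xₙ) + ΣF (λ j → Q (αmid M j + x (inject₁ j)))
        ≡⟨ cong₂ _+_ (T-+ (αlast M) xₙ) (trans (ΣF-cong (λ j → trans (Q-split (αmid M j) (x (inject₁ j))) (+-assoc _ _ _)))
            (ΣF-distrib-+ (Q ∘ αmid M) S)) ⟩
      T (αlast M) + T xₙ + (ΣF (Q ∘ αmid M) + ΣF S)
        ≡⟨ solve 4 (λ A B C D → A :+ B :+ (C :+ D) := (A :+ C) :+ (B :- (:- D))) refl (T (αlast M)) (T xₙ) (ΣF (Q ∘ αmid M)) (ΣF S) ⟩
      (T (αlast M) + ΣF (Q ∘ αmid M)) + (T xₙ - (- ΣF S))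
        ≡⟨ cong₂ _+_ (InR-equation M M∈R) (cong (λ t → T xₙ - t) (sym (ΣF-neg S))) ⟩
      0# + (T xₙ - ΣF (λ j → h M j (x (inject₁ j))))
        ≡⟨ +-identityˡ _ ⟩
      T xₙ - ΣF (λ j → h M j (x (inject₁ j)))
        ∎
      where
        xₙ = x (fromℕ m)
        S : Fin m → K
        S j = Q (x (inject₁ j)) + L (u (αmid M j)) (x (inject₁ j))

    private
      t-s≡0⇒t≡0+s : ∀ {t s} → t - s ≡ 0# → t ≡ 0# + s
      t-s≡0⇒t≡0+s t-s≡0 = trans (x-y≡0⇒x≡y t-s≡0) (sym (+-identityˡ _))
      t≡0+s⇒t-s≡0 : ∀ {t s} → t ≡ 0# + s → t - s ≡ 0#
      t≡0+s⇒t-s≡0 t≡0+s = x≡y⇒x-y≡0 (trans t≡0+s (+-identityˡ _))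

    count-affine-zeros : ∀ M → InR (suc m) q a b C M →
      count (zero? M) (allVecs (suc m)) ≡ q ℕ.* size ℕ.^ m
    count-affine-zeros M M∈R = begin
      count (zero? M) (allVecs (suc m))
        ≡⟨ count-≐ (zero? M) (system? m (λ _ → L 0#) (h M) 0# 0#)
                   ((λ {x} → zero⇒system {x}) , (λ {x} → system⇒zero {x})) (allVecs (suc m)) ⟩
      count (system? m (λ _ → L 0#) (h M) 0# 0#) (allVecs (suc m))
        ≡⟨ count-system m (λ _ → L 0#) (h M) 0# (traceZero-h M) traceZero-0 ⟩
      q ℕ.* solutions m (λ _ → L 0#) 0#
        ≡⟨ cong (q ℕ.*_) (solutions-zero-forms m (λ _ → L 0#) (λ _ → L-0) 0#) ⟩
      q ℕ.* (size ℕ.^ m ℕ.* indicator (0# ≟_) 0#)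
        ≡⟨ cong (λ i → q ℕ.* (size ℕ.^ m ℕ.* i)) (indicator-yes (0# ≟_) refl) ⟩
      q ℕ.* (size ℕ.^ m ℕ.* 1)
        ≡⟨ cong (q ℕ.*_) (ℕ.*-identityʳ _) ⟩
      q ℕ.* size ℕ.^ m
        ∎
      where
        zero⇒system : ∀ {x} → F^ M (affine x) ≡ 0# → System m (λ _ → L 0#) (h M) 0# 0# x
        zero⇒system {x} F≡0 = ΣF-zero _ (λ j → L-0 (x (inject₁ j))) , t-s≡0⇒t≡0+s (trans (sym (F^≡T-Σh M M∈R x)) F≡0)
        system⇒zero : ∀ {x} → System m (λ _ → L 0#) (h M) 0# 0# x → F^ M (affine x) ≡ 0#
        system⇒zero {x} (_ , T≡0+Σh) = trans (F^≡T-Σh M M∈R x) (t≡0+s⇒t-s≡0 T≡0+Σh)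

    module _ (M M′ : Matrix (suc m)) (M∈R : InR (suc m) q a b C M) (M′∈R : InR (suc m) q a b C M′) where

      w : Fin m → K
      w j = u (αmid M j) - u (αmid M′ j)

      ΣLw : (Fin (suc m) → K) → K
      ΣLw x = ΣF (λ j → L (w j) (x (inject₁ j)))

      F^M′≡F^M-ΣLw : ∀ x → F^ M′ (affine x) ≡ F^ M (affine x) - ΣLw x
      F^M′≡F^M-ΣLw x = begin
        F^ M′ (affine x)
          ≡⟨ F^≡T-Σh M′ M′∈R x ⟩
        T xₙ - ΣF (λ j → h M′ j (x (inject₁ j)))
          ≡⟨ cong (λ t → T xₙ - t)
               (trans (ΣF-cong h′≡h+Lw) (ΣF-distrib-+ (λ j → h M j (x (inject₁ j))) (λ j → L (w j) (x (inject₁ j))))) ⟩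
        T xₙ - (ΣF (λ j → h M j (x (inject₁ j))) + ΣLw x)
          ≡⟨ solve 3 (λ t H S → t :- (H :+ S) := t :- H :- S) refl (T xₙ) _ _ ⟩
        T xₙ - ΣF (λ j → h M j (x (inject₁ j))) - ΣLw x
          ≡⟨ cong (_- ΣLw x) (F^≡T-Σh M M∈R x) ⟨
        F^ M (affine x) - ΣLw x
          ∎
        where
          xₙ = x (fromℕ m)
          h′≡h+Lw : ∀ j → h M′ j (x (inject₁ j)) ≡ h M j (x (inject₁ j)) + L (w j) (x (inject₁ j))
          h′≡h+Lw j =
            trans (solve 3 (λ Q A B → :- (Q :+ B) := :- (Q :+ A) :+ (A :- B)) refl (Q y) (L (u (αmid M j)) y) (L (u (αmid M′ j)) y))
                  (cong (h M j y +_) (sym (L-sub (u (αmid M j)) (u (αmid M′ j)) y)))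
            where y = x (inject₁ j)

      count-common-zeros : D ≢ 0# → Σ (Fin m) (λ j → αmid M j ≢ αmid M′ j) →
        count (λ x → zero? M x ×-dec zero? M′ x) (allVecs (suc m)) ≡ size ℕ.^ m
      count-common-zeros D≢0 (j , αj≢α′j) = begin
        count (λ x → zero? M x ×-dec zero? M′ x) (allVecs (suc m))
          ≡⟨ count-≐ (λ x → zero? M x ×-dec zero? M′ x) (system? m (L ∘ w) (h M) 0# 0#)
                     ((λ {x} → zeros⇒system {x}) , (λ {x} → system⇒zeros {x})) (allVecs (suc m)) ⟩
        count (system? m (L ∘ w) (h M) 0# 0#) (allVecs (suc m))
          ≡⟨ count-system m (L ∘ w) (h M) 0# (traceZero-h M) traceZero-0 ⟩
        q ℕ.* solutions m (L ∘ w) 0#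
          ≡⟨ solutions-L m w (j , wj≢0) traceZero-0 ⟩
        size ℕ.^ m
          ∎
        where
          wj≢0 : w j ≢ 0#
          wj≢0 wj≡0 = αj≢α′j (x-y≡0⇒x≡y (u-injective D≢0 (trans (sym (u-sub _ _)) wj≡0)))
          zeros⇒system : ∀ {x} → (F^ M (affine x) ≡ 0#) × (F^ M′ (affine x) ≡ 0#) → System m (L ∘ w) (h M) 0# 0# x
          zeros⇒system {x} (F≡0 , F′≡0) =
              sym (x-y≡0⇒x≡y (trans (cong (_- ΣLw x) (sym F≡0)) (trans (sym (F^M′≡F^M-ΣLw x)) F′≡0)))
            , t-s≡0⇒t≡0+s (trans (sym (F^≡T-Σh M M∈R x)) F≡0)
          system⇒zeros : ∀ {x} → System m (L ∘ w) (h M) 0# 0# x → (F^ M (affine x) ≡ 0#) × (F^ M′ (affine x) ≡ 0#)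
          system⇒zeros {x} (ΣLw≡0 , T≡0+Σh) = F≡0 , trans (F^M′≡F^M-ΣLw x) (trans (cong₂ _-_ F≡0 ΣLw≡0) (-‿inverseʳ 0#))
            where
              F≡0 : F^ M (affine x) ≡ 0#
              F≡0 = trans (F^≡T-Σh M M∈R x) (t≡0+s⇒t-s≡0 T≡0+Σh)

      -- Equal middle entries force T(α_n) = T(α′_n), so α_n − α′_n ∈ GF(q), and the transversal leaves one choice.
      αmid-equal⇒equal : IsTransversal q C → (∀ j → αmid M j ≡ αmid M′ j) → ∀ i j → M i j ≡ M′ i j
      αmid-equal⇒equal _ _ (suc i) j = trans (proj₁ (proj₂ M∈R) i j) (sym (proj₁ (proj₂ M′∈R) i j))
      αmid-equal⇒equal _ _ zero zero = trans (proj₁ M∈R) (sym (proj₁ M′∈R))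
      αmid-equal⇒equal (_ , _ , unique-rep) αmid≡ zero (suc j) with view j
      ... | ‵inject₁ k = αmid≡ k
      ... | ‵fromℕ = unique-rep (αlast M) (αlast M′) (proj₁ (proj₂ (proj₂ M∈R))) (proj₁ (proj₂ (proj₂ M′∈R))) difference∈Fq
        where
          Tαₙ≡Tα′ₙ : T (αlast M) ≡ T (αlast M′)
          Tαₙ≡Tα′ₙ = begin
            T (αlast M)                      ≡⟨ x+y≡0⇒x≡-y (InR-equation M M∈R) ⟩
            - ΣF (Q ∘ αmid M)                ≡⟨ cong -_ (ΣF-cong (cong Q ∘ αmid≡)) ⟩
            - ΣF (Q ∘ αmid M′)               ≡⟨ x+y≡0⇒x≡-y (InR-equation M′ M′∈R) ⟨
            T (αlast M′)                     ∎
          difference∈Fq : InSub q (αlast M - αlast M′)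
          difference∈Fq = begin
            φ (αlast M - αlast M′)
              ≡⟨ φ-sub (αlast M) (αlast M′) ⟩
            φ (αlast M) - φ (αlast M′)
              ≡⟨ solve 4 (λ A x B y → A :- B := (A :- x) :- (B :- y) :+ (x :- y)) refl
                  (φ (αlast M)) (αlast M) (φ (αlast M′)) (αlast M′) ⟩
            T (αlast M) - T (αlast M′) + (αlast M - αlast M′)
              ≡⟨ cong (_+ (αlast M - αlast M′)) (x≡y⇒x-y≡0 Tαₙ≡Tα′ₙ) ⟩
            0# + (αlast M - αlast M′)
              ≡⟨ +-identityˡ _ ⟩
            αlast M - αlast M′
              ∎

      αmid-differ : IsTransversal q C → ¬ (∀ i j → M i j ≡ M′ i j) → Σ (Fin m) (λ j → αmid M j ≢ αmid M′ j)
      αmid-differ transversal M≢M′ = Fin.¬∀⟶∃¬ m _ (λ j → αmid M j ≟ αmid M′ j) (M≢M′ ∘ αmid-equal⇒equal transversal)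

      module _ (D≢0 : D ≢ 0#) (transversal : IsTransversal q C) (M≢M′ : ¬ (∀ i j → M i j ≡ M′ i j)) where

        commonAffine≡size^m : commonAffine (suc m) (F^ M) (F^ M′) ≡ size ℕ.^ m
        commonAffine≡size^m = count-common-zeros D≢0 (αmid-differ transversal M≢M′)

        -- Were the varieties equal, every affine zero of F^ M would be common: q · |K|^m = |K|^m.
        distinct-varieties : ¬ SameVariety (F^ M) (F^ M′)
        distinct-varieties same =
          ℕ.<⇒≢ 2≤q (sym (ℕ.*-cancelʳ-≡ q 1 (size ℕ.^ m) ⦃ ℕ.m^n≢0 size m ⦃ nonempty (complete 0#) ⦄ ⦄ (begin
          q ℕ.* size ℕ.^ m
            ≡⟨ count-affine-zeros M M∈R ⟨
          count (zero? M) (allVecs (suc m))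
            ≡⟨ count-≐ _ (λ x → zero? M x ×-dec zero? M′ x) ((λ {x} → zero⇒common-zero {x}) , proj₁) (allVecs (suc m)) ⟩
          commonAffine (suc m) (F^ M) (F^ M′)
            ≡⟨ commonAffine≡size^m ⟩
          size ℕ.^ m
            ≡⟨ ℕ.*-identityˡ _ ⟨
          1 ℕ.* size ℕ.^ m
            ∎)))
          where
            zero⇒common-zero : ∀ {x} → F^ M (affine x) ≡ 0# → (F^ M (affine x) ≡ 0#) × (F^ M′ (affine x) ≡ 0#)
            zero⇒common-zero {x} F≡0 = F≡0 , Equivalence.to (same (affine x) (λ all≡0 → 0≢1 (sym (all≡0 zero)))) F≡0
            nonempty : ∀ {xs : List K} → 0# ∈ xs → ℕ.NonZero (length xs)
            nonempty {_ ∷ _} _ = _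

[q^2]^m≡q^[2[1+m]-2] : ∀ q m → (q ℕ.^ 2) ℕ.^ m ≡ q ℕ.^ (2 ℕ.* suc m ℕ.∸ 2)
[q^2]^m≡q^[2[1+m]-2] q m = begin
  (q ℕ.^ 2) ℕ.^ m                 ≡⟨ ℕ.^-*-assoc q 2 m ⟩
  q ℕ.^ (2 ℕ.* m)                 ≡⟨ cong (q ℕ.^_) (ℕ.m+n∸m≡n 2 (2 ℕ.* m)) ⟨
  q ℕ.^ (2 ℕ.+ 2 ℕ.* m ℕ.∸ 2)     ≡⟨ cong (λ e → q ℕ.^ (e ℕ.∸ 2)) (ℕ.*-suc 2 m) ⟨
  q ℕ.^ (2 ℕ.* suc m ℕ.∸ 2)       ∎
  where open ≡-Reasoning

mainTheorem1 : (𝔽 : FiniteField) (q n : ℕ) →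
    let open FieldDefs 𝔽 in
    (a b : K) (C : K → Set) →
    IsPrimePower q → size ≡ q ℕ.^ 2 → 2 ≤ n →
    ¬ (a ≡ 0#) → ¬ InSub q b →
    ((IsOdd n × IsOdd q × ¬ (4# * a ^ᴷ (suc q) + (b ^ᴷ q - b) * (b ^ᴷ q - b) ≡ 0#))
     ⊎ (IsEven n × IsOdd q × NonSquareInSub q (4# * a ^ᴷ (suc q) + (b ^ᴷ q - b) * (b ^ᴷ q - b)))
     ⊎ (IsEven n × IsEven q × Tr q (a ^ᴷ (suc q) / ((b ^ᴷ q + b) * (b ^ᴷ q + b))) ≡ 0#)
     ⊎ (IsOdd n × IsEven q)) →
    IsTransversal q C →
    ∀ (M M' : Matrix n) → InR n q a b C M → InR n q a b C M' →
    ¬ (∀ i j → M i j ≡ M' i j) →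
    ¬ SameVariety (Fform n q a b ^[ M ]) (Fform n q a b ^[ M' ])
    × commonAffine n (Fform n q a b ^[ M ]) (Fform n q a b ^[ M' ]) ≡ q ℕ.^ (2 ℕ.* n ℕ.∸ 2)
mainTheorem1 𝔽 q (suc m) a b C q-prime-power size≡q² (s≤s _) _ b∉Fq conditions transversal M M′ M∈R M′∈R M≢M′ =
    distinct-varieties M M′ M∈R M′∈R D≢0 transversal M≢M′
  , (begin
      commonAffine (suc m) (F^ M) (F^ M′)   ≡⟨ commonAffine≡size^m M M′ M∈R M′∈R D≢0 transversal M≢M′ ⟩
      size ℕ.^ m                            ≡⟨ cong (ℕ._^ m) size≡q² ⟩
      (q ℕ.^ 2) ℕ.^ m                       ≡⟨ [q^2]^m≡q^[2[1+m]-2] q m ⟩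
      q ℕ.^ (2 ℕ.* suc m ℕ.∸ 2)             ∎)
  where
    open FieldDefs 𝔽
    open Variety 𝔽 q q-prime-power size≡q² b b∉Fq a C
    open ≡-Reasoning

    -- The conditions (i)–(iv) enter only through D ≢ 0.
    D≢0 : D ≢ 0#
    D≢0 = [ proj₂ ∘ proj₂
          , [ nonsquare⇒D≢0 ∘ proj₂ ∘ proj₂
            , [ even⇒D≢0 ∘ proj₁ ∘ proj₂ , even⇒D≢0 ∘ proj₂ ]′ ]′ ]′ conditions
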